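{- Let $G \ne K_4$ be a connected, claw-free, cubic graph of order $n$. Then $F(G) \le \frac{1}{2}n$, with equality if and only if $G$ is the diamond-necklace $N_2$ or the prism $C_3 \,\Box\, K_2$.
   Context: Graphs are finite and simple. A graph is claw-free if it contains no induced $K_{1,3}$. Forcing process: given $S \subseteq V(G)$ of initially colored vertices, at each step, if a colored vertex has exactly one non-colored neighbor, that neighbor becomes colored. $S$ is a forcing set (zero forcing set) if iterating this process colors all of $V(G)$; $F(G)$ is the minimum size of a forcing set. A diamond is $K_4$ minus an edge. The diamond-necklace $N_2$ is obtained from two disjoint diamonds $D_1, D_2$ with $V(D_i)=\{a_i,b_i,c_i,d_i\}$ and $a_ib_i$ the missing edge of $D_i$, by adding the edges $a_1b_2$ and $a_2b_1$. The prism $C_3 \,\Box\, K_2$ is the Cartesian product of a triangle and an edge. -}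

module Defs where

open import Data.Nat using (ℕ; zero; suc; _+_; _*_; _≤_)
open import Data.Bool using (Bool; true; false; if_then_else_; _∧_; _∨_; T)
open import Data.Fin using (Fin; _≟_; #_) renaming (zero to f0; suc to fs)
open import Data.Fin.Subset using (Subset; _∈_; ∣_∣)
open import Data.List using (List; []; _∷_; map; allFin)
open import Data.Nat.ListAction using (sum)
open import Data.Bool.ListAction using (any)
open import Data.Product using (Σ; ∃; _×_; _,_)
open import Relation.Binary.PropositionalEquality using (_≡_; _≢_)
open import Relation.Nullary using (¬_)
open import Relation.Nullary.Decidable using (⌊_⌋)
open import Relation.Binary.Construct.Closure.ReflexiveTransitive using (Star)
open import Function.Bundles using (_⤖_; Bijection)

record Graph (n : ℕ) : Set where
  field
    adj    : Fin n → Fin n → Bool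
    sym    : ∀ u v → adj u v ≡ adj v u
    irrefl : ∀ v → adj v v ≡ false
open Graph public

Adj : ∀ {n} → Graph n → Fin n → Fin n → Set
Adj G u v = T (adj G u v)

degree : ∀ {n} → Graph n → Fin n → ℕ
degree {n} G v = sum (map (λ w → if adj G v w then 1 else 0) (allFin n))

Cubic : ∀ {n} → Graph n → Set
Cubic G = ∀ v → degree G v ≡ 3

-- connected: nonempty, and any two vertices are joined by a walk
Connected : ∀ {n} → Graph n → Set
Connected {n} G = Fin n × (∀ u v → Star (Adj G) u v)

IsClaw : ∀ {n} → Graph n → Fin n → Fin n → Fin n → Fin n → Set
IsClaw G v a b c =
  Adj G v a × Adj G v b × Adj G v c ×
  a ≢ b × a ≢ c × b ≢ c ×
  ¬ Adj G a b × ¬ Adj G a c × ¬ Adj G b c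

ClawFree : ∀ {n} → Graph n → Set
ClawFree {n} G = ∀ (v a b c : Fin n) → ¬ IsClaw G v a b c

data Colored {n} (G : Graph n) (S : Subset n) : Fin n → Set where
  initial : ∀ {v} → v ∈ S → Colored G S v
  force   : ∀ {u w} → Colored G S u → Adj G u w →
            (∀ x → Adj G u x → x ≢ w → Colored G S x) →
            Colored G S w

ForcingSet : ∀ {n} → Graph n → Subset n → Set
ForcingSet {n} G S = ∀ v → Colored G S v

IsForcingNumber : ∀ {n} → Graph n → ℕ → Set
IsForcingNumber {n} G k =
  (Σ (Subset n) λ S → ForcingSet G S × ∣ S ∣ ≡ k) ×
  (∀ (S : Subset n) → ForcingSet G S → k ≤ ∣ S ∣)

Isomorphic : ∀ {n m} → Graph n → (Fin m → Fin m → Bool) → Set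
Isomorphic {n} {m} G H =
  Σ (Fin n ⤖ Fin m) λ f →
    ∀ u v → adj G u v ≡ H (Bijection.to f u) (Bijection.to f v)

fromEdges : ∀ {m} → List (Fin m × Fin m) → Fin m → Fin m → Bool
fromEdges es u v =
  any (λ { (a , b) → (⌊ a ≟ u ⌋ ∧ ⌊ b ≟ v ⌋) ∨ (⌊ a ≟ v ⌋ ∧ ⌊ b ≟ u ⌋) }) es

K4 : Fin 4 → Fin 4 → Bool
K4 u v = if ⌊ u ≟ v ⌋ then false else true

-- diamond-necklace N2: vertices a1 b1 c1 d1 a2 b2 c2 d2 = 0..7
N2 : Fin 8 → Fin 8 → Bool
N2 = fromEdges
  ( (# 0 , # 2) ∷ (# 0 , # 3) ∷ (# 1 , # 2) ∷ (# 1 , # 3) ∷ (# 2 , # 3)     -- diamond D1 (missing a1b1)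
  ∷ (# 4 , # 6) ∷ (# 4 , # 7) ∷ (# 5 , # 6) ∷ (# 5 , # 7) ∷ (# 6 , # 7)     -- diamond D2 (missing a2b2)
  ∷ (# 0 , # 5) ∷ (# 4 , # 1)                                   -- a1b2, a2b1
  ∷ [])

Prism : Fin 6 → Fin 6 → Bool
Prism = fromEdges
  ( (# 0 , # 1) ∷ (# 1 , # 2) ∷ (# 0 , # 2)
  ∷ (# 3 , # 4) ∷ (# 4 , # 5) ∷ (# 3 , # 5)
  ∷ (# 0 , # 3) ∷ (# 1 , # 4) ∷ (# 2 , # 5)
  ∷ [])

-- The upper bound comes from a greedy argument: if a seed list L of initially coloured
-- vertices is anchored (each seed vertex has a coloured neighbour) and not yet forcing, then,
-- walking from the seed to an uncoloured vertex, we find a coloured vertex with a coloured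
-- neighbour and two uncoloured ones; adding one of these to L colours both.  So each added seed
-- pays for two coloured vertices, and a forcing list L′ with 2∣L′∣ + ∣coloured(L)∣ ≤ n + 2∣L∣
-- exists.  A Seed, an anchored list colouring more than 2∣L∣ vertices, thus gives 2F(G) < n.
-- The structural part shows that a connected claw-free cubic G ≠ K4 has a Seed unless it is
-- isomorphic to N2 or to the prism: every vertex lies in a triangle, which either extends to a
-- diamond (Diamond) or has three distinct outer neighbours (TriangleBasics, Triangle); a short
-- local case analysis then finds a Seed or the exceptional graph.  For N2 and the prism the
-- forcing numbers 4 and 3 are computed by exhaustive search and transferred along isomorphisms.

module Submission where

open import Defs
open import Data.Nat using (ℕ; zero; suc; _+_; _*_; _≤_; _<_; s≤s)
open import Data.Nat.Properties
  using (≤-refl; ≤-reflexive; ≤-trans; ≤-antisym; ≤-pred; <-irrefl; n≮0; <⇒≤; ≮⇒≥; _<?_; <-≤-trans; ≤-<-trans;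
         +-suc; +-comm; +-identityʳ; *-suc; +-monoʳ-≤; +-monoʳ-<; +-cancelˡ-≤; +-cancelʳ-<; *-monoʳ-≤;
         m≤m+n; n≤1+n; module ≤-Reasoning)
  renaming (_≟_ to _≟ℕ_)
open import Data.Bool using (Bool; true; false; if_then_else_; T; _∧_; _∨_)
open import Data.Bool.Properties using (T-∧; T-∨) renaming (_≟_ to _≟ᵇ_)
open import Data.Fin using (Fin; _≟_; #_) renaming (zero to fzero; suc to fsuc)
open import Data.Fin.Properties using (any?; all?; ¬∀⟶∃¬; cantor-schröder-bernstein)
open import Data.Fin.Subset using (Subset; _∈_; _∉_; _⊆_; ∣_∣; ⊤; ⁅_⁆; _∪_; _-_; inside; outside)
  renaming (⊥ to ∅)
open import Data.Fin.Subset.Properties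
  using (_∈?_; _⊆?_; anySubset?; ∈⊤; ∉⊥; ∣p∣≤n; ∣p∣≡n⇒p≡⊤; ∣⊥∣≡0; ∣p∣≤∣x∷p∣; p⊂q⇒∣p∣<∣q∣; p⊆q⇒∣p∣≤∣q∣;
         x∈p⇒∣p-x∣<∣p∣; x∈p∧x≢y⇒x∈p-y; ∪-identityˡ; x∈p∪q⁺; x∈p∪q⁻; x∈⁅x⁆; x∈⁅y⁆⇒x≡y)
open import Data.Vec using ([]; _∷_; tabulate; _[_]=_)
open import Data.Vec.Properties using ([]=⇒lookup; lookup⇒[]=; lookup∘tabulate)
open import Data.List using (List; []; _∷_; length; map; allFin; filter; lookup)
open import Data.List.Properties using (length-map)
open import Data.List.Membership.Propositional using () renaming (_∈_ to _∈ₗ_)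
open import Data.List.Membership.Propositional.Properties using (∈-allFin; ∈-map⁺; ∈-filter⁺; ∈-filter⁻; ∈-lookup)
open import Data.List.Relation.Unary.Any as Any using (here; there)
open import Data.List.Relation.Unary.Any.Properties using (any⁺; any⁻)
open import Data.List.Relation.Unary.All as All using (All; []; _∷_)
open import Data.List.Relation.Unary.All.Properties using (All¬⇒¬Any; ¬Any⇒All¬)
open import Data.List.Relation.Unary.AllPairs using (AllPairs; []; _∷_)
open import Data.List.Relation.Unary.Unique.Propositional using (Unique)
open import Data.List.Relation.Unary.Unique.Propositional.Properties using (allFin⁺; filter⁺)
open import Data.Nat.ListAction using (sum)
open import Data.Product using (∃; _×_; _,_; proj₁; proj₂)
open import Data.Sum using (_⊎_; inj₁; inj₂; [_,_]′)
open import Data.Empty using (⊥-elim)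
open import Function using (_∘_)
open import Function.Bundles using (_⇔_; Bijection; Equivalence; mk⤖; mk⇔)
open import Relation.Binary.PropositionalEquality
  using (_≡_; _≢_; refl; trans; cong; cong₂; subst; subst₂; ≢-sym) renaming (sym to ≡-sym)
open import Relation.Nullary using (¬_; Dec; yes; no)
open import Relation.Nullary.Decidable
  using (⌊_⌋; T?; toWitness; fromWitness; from-yes; from-no; map′; ¬?; _×-dec_; _⊎-dec_; _→-dec_)
open import Relation.Binary.Construct.Closure.ReflexiveTransitive using (Star; ε; _◅_)

module _ {n : ℕ} (G : Graph n) where

  adj-sym : ∀ {u v} → Adj G u v → Adj G v u
  adj-sym {u} {v} = subst T (sym G u v)

  adj⇒≢ : ∀ {u v} → Adj G u v → u ≢ v
  adj⇒≢ {v = v} uv refl = subst T (irrefl G v) uv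

Adj? : ∀ {n} (G : Graph n) u v → Dec (Adj G u v)
Adj? G u v = T? (adj G u v)

length-filter-T : ∀ {A : Set} (f : A → Bool) (xs : List A) →
                  length (filter (T? ∘ f) xs) ≡ sum (map (λ w → if f w then 1 else 0) xs)
length-filter-T f [] = refl
length-filter-T f (x ∷ xs) with f x
... | true  = cong suc (length-filter-T f xs)
... | false = length-filter-T f xs

record Nbhd {n : ℕ} (G : Graph n) (v a b c : Fin n) : Set where
  constructor nbhd
  field
    va   : Adj G v a
    vb   : Adj G v b
    vc   : Adj G v c
    a≢b  : a ≢ b
    a≢c  : a ≢ c
    b≢c  : b ≢ c
    only : ∀ w → Adj G v w → w ≡ a ⊎ w ≡ b ⊎ w ≡ c

cubic-nbhd : ∀ {n} (G : Graph n) → Cubic G → ∀ v → ∃ λ a → ∃ λ b → ∃ λ c → Nbhd G v a b c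
cubic-nbhd {n} G cubic v =
  fromList3 neighbours length≡3 (filter⁺ P? (allFin⁺ n))
    (λ w∈ → proj₂ (∈-filter⁻ P? {xs = allFin n} w∈)) (λ w → ∈-filter⁺ P? (∈-allFin w))
  where
  P? : ∀ w → Dec (Adj G v w)
  P? = Adj? G v
  neighbours : List (Fin n)
  neighbours = filter P? (allFin n)
  length≡3 : length neighbours ≡ 3
  length≡3 = trans (length-filter-T (adj G v) (allFin n)) (cubic v)
  fromList3 : ∀ ws → length ws ≡ 3 → Unique ws → (∀ {w} → w ∈ₗ ws → Adj G v w) →
              (∀ w → Adj G v w → w ∈ₗ ws) → ∃ λ a → ∃ λ b → ∃ λ c → Nbhd G v a b c
  fromList3 (a ∷ b ∷ c ∷ []) refl ((a≢b ∷ a≢c ∷ []) ∷ (b≢c ∷ []) ∷ _) sound complete =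
    a , b , c , nbhd (sound (here refl)) (sound (there (here refl))) (sound (there (there (here refl))))
                     a≢b a≢c b≢c only
    where
    only : ∀ w → Adj G v w → w ≡ a ⊎ w ≡ b ⊎ w ≡ c
    only w vw with complete w vw
    ... | here w≡a                 = inj₁ w≡a
    ... | there (here w≡b)         = inj₂ (inj₁ w≡b)
    ... | there (there (here w≡c)) = inj₂ (inj₂ w≡c)

module _ {n : ℕ} {G : Graph n} where

  nbhd-swap₁₂ : ∀ {v a b c} → Nbhd G v a b c → Nbhd G v b a c
  nbhd-swap₁₂ (nbhd va vb vc a≢b a≢c b≢c only) =
    nbhd vb va vc (≢-sym a≢b) b≢c a≢c
      (λ w vw → [ inj₂ ∘ inj₁ , [ inj₁ , inj₂ ∘ inj₂ ]′ ]′ (only w vw))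

  nbhd-swap₂₃ : ∀ {v a b c} → Nbhd G v a b c → Nbhd G v a c b
  nbhd-swap₂₃ (nbhd va vb vc a≢b a≢c b≢c only) =
    nbhd va vc vb a≢c a≢b (≢-sym b≢c)
      (λ w vw → [ inj₁ , [ inj₂ ∘ inj₂ , inj₂ ∘ inj₁ ]′ ]′ (only w vw))

  nbhd-rotate : ∀ {v a b c} → Nbhd G v a b c → Nbhd G v b c a
  nbhd-rotate = nbhd-swap₂₃ ∘ nbhd-swap₁₂

  not-adj : ∀ {v a b c w} → Nbhd G v a b c → w ≢ a → w ≢ b → w ≢ c → ¬ Adj G v w
  not-adj N w≢a w≢b w≢c vw with Nbhd.only N _ vw
  ... | inj₁ w≡a        = w≢a w≡a
  ... | inj₂ (inj₁ w≡b) = w≢b w≡b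
  ... | inj₂ (inj₂ w≡c) = w≢c w≡c

  nbhd-with₁ : ∀ {v a b c x} → Nbhd G v a b c → Adj G v x → ∃ λ y → ∃ λ z → Nbhd G v x y z
  nbhd-with₁ N vx with Nbhd.only N _ vx
  ... | inj₁ refl        = _ , _ , N
  ... | inj₂ (inj₁ refl) = _ , _ , nbhd-swap₁₂ N
  ... | inj₂ (inj₂ refl) = _ , _ , nbhd-swap₁₂ (nbhd-swap₂₃ N)

  nbhd-with₂ : ∀ {v a b c x y} → Nbhd G v a b c → Adj G v x → Adj G v y → x ≢ y → ∃ λ z → Nbhd G v x y z
  nbhd-with₂ N vx vy x≢y with nbhd-with₁ N vx
  ... | _ , _ , N′ with Nbhd.only N′ _ vy
  ... | inj₁ y≡x         = ⊥-elim (x≢y (≡-sym y≡x))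
  ... | inj₂ (inj₁ refl) = _ , N′
  ... | inj₂ (inj₂ refl) = _ , nbhd-swap₂₃ N′

  force-third : ∀ {S u a b c} → Nbhd G u a b c → Colored G S a → Colored G S b → Colored G S u → Colored G S c
  force-third {S} N ca cb cu = force cu (Nbhd.vc N) coloured-others
    where
    coloured-others : ∀ x → Adj G _ x → x ≢ _ → Colored G S x
    coloured-others x ux x≢c with Nbhd.only N x ux
    ... | inj₁ refl        = ca
    ... | inj₂ (inj₁ refl) = cb
    ... | inj₂ (inj₂ x≡c)  = ⊥-elim (x≢c x≡c)

  colored-mono : ∀ {S S′} → S ⊆ S′ → ∀ {v} → Colored G S v → Colored G S′ v
  colored-mono S⊆S′ (initial v∈S) = initial (S⊆S′ v∈S)
  colored-mono S⊆S′ (force cu uw rest) =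
    force (colored-mono S⊆S′ cu) uw (λ x ux x≢w → colored-mono S⊆S′ (rest x ux x≢w))

module _ {n : ℕ} {P : Fin n → Set} (P? : ∀ x → Dec (P x)) where

  ∈-tabulate⁻ : ∀ {x} → x ∈ tabulate (λ y → ⌊ P? y ⌋) → P x
  ∈-tabulate⁻ {x} x∈ = toWitness (subst T (trans (≡-sym ([]=⇒lookup x∈)) (lookup∘tabulate _ x)) _)

  ∈-tabulate⁺ : ∀ {x} → P x → x ∈ tabulate (λ y → ⌊ P? y ⌋)
  ∈-tabulate⁺ {x} px = lookup⇒[]= x _ (trans (lookup∘tabulate _ x) (T⇒≡true (fromWitness px)))
    where
    T⇒≡true : ∀ {b} → T b → b ≡ true
    T⇒≡true {true} _ = refl

-- The forcing process is decidable: iterating "add every forced vertex" until nothing changes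
-- computes exactly the set of vertices eventually coloured from S.
module _ {n : ℕ} (G : Graph n) where

  Forces : Subset n → Fin n → Set
  Forces C w = ∃ λ u → u ∈ C × Adj G u w × (∀ x → Adj G u x → x ≢ w → x ∈ C)

  forces? : ∀ C w → Dec (Forces C w)
  forces? C w = any? λ u → (u ∈? C) ×-dec (Adj? G u w ×-dec
                  all? (λ x → Adj? G u x →-dec (¬? (x ≟ w) →-dec (x ∈? C))))

  Closed : Subset n → Set
  Closed C = ∀ w → Forces C w → w ∈ C

  step : Subset n → Subset n
  step C = tabulate (λ w → ⌊ (w ∈? C) ⊎-dec forces? C w ⌋)

  C⊆step : ∀ C → C ⊆ step C
  C⊆step C w∈C = ∈-tabulate⁺ (λ w → (w ∈? C) ⊎-dec forces? C w) (inj₁ w∈C)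

  iterate : ℕ → Subset n → Subset n
  iterate zero    C = C
  iterate (suc k) C with step C ⊆? C
  ... | yes _ = C
  ... | no  _ = iterate k (step C)

  step-grows : ∀ C → ¬ step C ⊆ C → ∣ C ∣ < ∣ step C ∣
  step-grows C step⊈C = p⊂q⇒∣p∣<∣q∣ (C⊆step C , new)
    where
    new : ∃ λ x → x ∈ step C × x ∉ C
    new with any? (λ x → (x ∈? step C) ×-dec ¬? (x ∈? C))
    ... | yes found = found
    ... | no none = ⊥-elim (step⊈C λ {x} x∈ → old x x∈)
      where
      old : ∀ x → x ∈ step C → x ∈ C
      old x x∈ with x ∈? C
      ... | yes x∈C = x∈C
      ... | no  x∉C = ⊥-elim (none (x , x∈ , x∉C))

  -- Enough fuel (one unit per missing vertex) makes the result closed.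
  iterate-closed : ∀ k C → n ≤ k + ∣ C ∣ → Closed (iterate k C)
  iterate-closed zero C n≤∣C∣ w _ = subst (w ∈_) (≡-sym (∣p∣≡n⇒p≡⊤ (≤-antisym (∣p∣≤n C) n≤∣C∣))) ∈⊤
  iterate-closed (suc k) C fuel with step C ⊆? C
  ... | yes step⊆C = λ w C⇝w → step⊆C (∈-tabulate⁺ (λ w → (w ∈? C) ⊎-dec forces? C w) (inj₂ C⇝w))
  ... | no  step⊈C = iterate-closed k (step C)
          (≤-trans fuel (≤-trans (≤-reflexive (≡-sym (+-suc k ∣ C ∣))) (+-monoʳ-≤ k (step-grows C step⊈C))))

  iterate-⊇ : ∀ k C → C ⊆ iterate k C
  iterate-⊇ zero    C c = c
  iterate-⊇ (suc k) C c with step C ⊆? C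
  ... | yes _ = c
  ... | no  _ = iterate-⊇ k (step C) (C⊆step C c)

  iterate-sound : ∀ S k C → (∀ {x} → x ∈ C → Colored G S x) → ∀ {x} → x ∈ iterate k C → Colored G S x
  iterate-sound S zero C coloured x∈ = coloured x∈
  iterate-sound S (suc k) C coloured x∈ with step C ⊆? C
  ... | yes _ = coloured x∈
  ... | no  _ = iterate-sound S k (step C) coloured-step x∈
    where
    coloured-step : ∀ {x} → x ∈ step C → Colored G S x
    coloured-step y∈ with ∈-tabulate⁻ (λ w → (w ∈? C) ⊎-dec forces? C w) y∈
    ... | inj₁ y∈C = coloured y∈C
    ... | inj₂ (u , u∈C , uy , others) = force (coloured u∈C) uy (λ x ux x≢y → coloured (others x ux x≢y))

  closure : Subset n → Subset n
  closure S = iterate n S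

  closure-sound : ∀ S {x} → x ∈ closure S → Colored G S x
  closure-sound S = iterate-sound S n S initial

  -- The closure is closed under forcing, so it contains every coloured vertex.
  closure-complete : ∀ S {x} → Colored G S x → x ∈ closure S
  closure-complete S (initial x∈S) = iterate-⊇ n S x∈S
  closure-complete S (force {u} {w} cu uw others) =
    iterate-closed n S (m≤m+n n ∣ S ∣) w
      (u , closure-complete S cu , uw , λ x ux x≢w → closure-complete S (others x ux x≢w))

  colored? : ∀ S x → Dec (Colored G S x)
  colored? S x = map′ (closure-sound S) (closure-complete S) (x ∈? closure S)

  forcing? : ∀ S → Dec (ForcingSet G S)
  forcing? S = map′ (λ ⊤⊆ v → closure-sound S (⊤⊆ ∈⊤)) (λ forcing {x} _ → closure-complete S (forcing x)) (⊤ ⊆? closure S)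

  -- The forcing number exists: starting from any forcing set, repeatedly pass to a strictly
  -- smaller forcing set while one exists (the search over all subsets is decidable).
  forcing-number : ∃ λ k → IsForcingNumber G k
  forcing-number = minimise n ⊤ (λ v → initial ∈⊤) (∣p∣≤n ⊤)
    where
    minimise : ∀ bound S → ForcingSet G S → ∣ S ∣ ≤ bound → ∃ λ k → IsForcingNumber G k
    minimise bound S forcing size≤ with anySubset? (λ S′ → forcing? S′ ×-dec (∣ S′ ∣ <? ∣ S ∣))
    ... | no none = ∣ S ∣ , (S , forcing , refl) , λ S′ forcing′ → ≮⇒≥ (λ smaller → none (S′ , forcing′ , smaller))
    minimise zero S forcing size≤ | yes (S′ , _ , smaller) = ⊥-elim (n≮0 (<-≤-trans smaller size≤))
    minimise (suc bound) S forcing size≤ | yes (S′ , forcing′ , smaller) =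
      minimise bound S′ forcing′ (≤-pred (≤-trans smaller size≤))

fromList : ∀ {n} → List (Fin n) → Subset n
fromList []      = ∅
fromList (x ∷ L) = ⁅ x ⁆ ∪ fromList L

∣⁅x⁆∪p∣≤1+∣p∣ : ∀ {n} (x : Fin n) (p : Subset n) → ∣ ⁅ x ⁆ ∪ p ∣ ≤ suc ∣ p ∣
∣⁅x⁆∪p∣≤1+∣p∣ fzero    (b ∷ p)       rewrite ∪-identityˡ p = s≤s (∣p∣≤∣x∷p∣ b p)
∣⁅x⁆∪p∣≤1+∣p∣ (fsuc x) (inside ∷ p)  = s≤s (∣⁅x⁆∪p∣≤1+∣p∣ x p)
∣⁅x⁆∪p∣≤1+∣p∣ (fsuc x) (outside ∷ p) = ∣⁅x⁆∪p∣≤1+∣p∣ x p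

∣fromList∣≤length : ∀ {n} (L : List (Fin n)) → ∣ fromList L ∣ ≤ length L
∣fromList∣≤length {n} []    = ≤-reflexive (∣⊥∣≡0 n)
∣fromList∣≤length (x ∷ L) = ≤-trans (∣⁅x⁆∪p∣≤1+∣p∣ x (fromList L)) (s≤s (∣fromList∣≤length L))

∈-fromList⁺ : ∀ {n} {x : Fin n} {L} → x ∈ₗ L → x ∈ fromList L
∈-fromList⁺ {L = y ∷ L} (here refl) = x∈p∪q⁺ (inj₁ (x∈⁅x⁆ y))
∈-fromList⁺ {L = y ∷ L} (there x∈) = x∈p∪q⁺ (inj₂ (∈-fromList⁺ x∈))

∈-fromList⁻ : ∀ {n} {x : Fin n} {L} → x ∈ fromList L → x ∈ₗ L
∈-fromList⁻ {L = []}    x∈ = ⊥-elim (∉⊥ x∈)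
∈-fromList⁻ {L = y ∷ L} x∈ with x∈p∪q⁻ ⁅ y ⁆ (fromList L) x∈
... | inj₁ x∈⁅y⁆ = here (x∈⁅y⁆⇒x≡y y x∈⁅y⁆)
... | inj₂ x∈L   = there (∈-fromList⁻ x∈L)

fromList-⊆∷ : ∀ {n} (w : Fin n) L → fromList L ⊆ fromList (w ∷ L)
fromList-⊆∷ w L x∈ = x∈p∪q⁺ (inj₂ x∈)

members : ∀ {n} (p : Subset n) → ∃ λ L → length L ≡ ∣ p ∣ × (∀ {x} → x ∈ p → x ∈ₗ L)
members [] = [] , refl , λ ()
members (inside ∷ p) with members p
... | L , length≡ , listed = fzero ∷ map fsuc L , cong suc (trans (length-map fsuc L) length≡) ,
  λ { _[_]=_.here → here refl ; (_[_]=_.there x∈) → there (∈-map⁺ fsuc (listed x∈)) }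
members (outside ∷ p) with members p
... | L , length≡ , listed = map fsuc L , trans (length-map fsuc L) length≡ ,
  λ { (_[_]=_.there x∈) → ∈-map⁺ fsuc (listed x∈) }

distinct-count : ∀ {n} (L : List (Fin n)) (p q : Subset n) → Unique L → (∀ {x} → x ∈ₗ L → x ∈ q) →
                 (∀ {x} → x ∈ₗ L → x ∉ p) → p ⊆ q → length L + ∣ p ∣ ≤ ∣ q ∣
distinct-count []      p q _ _ _ p⊆q = p⊆q⇒∣p∣≤∣q∣ p⊆q
distinct-count (x ∷ L) p q (x∉L ∷ unique) L⊆q L∩p=∅ p⊆q =
  ≤-<-trans (distinct-count L p (q - x) unique L⊆q-x (L∩p=∅ ∘ there) p⊆q-x) (x∈p⇒∣p-x∣<∣p∣ (L⊆q (here refl)))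
  where
  L⊆q-x : ∀ {y} → y ∈ₗ L → y ∈ q - x
  L⊆q-x y∈L = x∈p∧x≢y⇒x∈p-y (L⊆q (there y∈L)) (λ { refl → All¬⇒¬Any x∉L y∈L })
  p⊆q-x : p ⊆ q - x
  p⊆q-x y∈p = x∈p∧x≢y⇒x∈p-y (p⊆q y∈p) (λ { refl → L∩p=∅ (here refl) y∈p })

distinct-length≤ : ∀ {n} (L : List (Fin n)) (q : Subset n) → Unique L → (∀ {x} → x ∈ₗ L → x ∈ q) →
                   length L ≤ ∣ q ∣
distinct-length≤ {n} L q unique L⊆q =
  ≤-trans (≤-reflexive (≡-sym (trans (cong (length L +_) (∣⊥∣≡0 n)) (+-identityʳ (length L)))))
          (distinct-count L ∅ q unique L⊆q (λ _ → ∉⊥) (λ x∈∅ → ⊥-elim (∉⊥ x∈∅)))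

distinct-exhaustive : ∀ {n} (L : List (Fin n)) (q : Subset n) → Unique L → (∀ {x} → x ∈ₗ L → x ∈ q) →
                      ∣ q ∣ ≤ length L → ∀ {x} → x ∈ q → x ∈ₗ L
distinct-exhaustive L q unique L⊆q ∣q∣≤ {x} x∈q with Any.any? (x ≟_) L
... | yes x∈L = x∈L
... | no  x∉L = ⊥-elim (<-irrefl refl (<-≤-trans (s≤s ∣q∣≤) longer))
  where
  longer : suc (length L) ≤ ∣ q ∣
  longer = distinct-length≤ (x ∷ L) q (¬Any⇒All¬ L x∉L ∷ unique) λ { (here refl) → x∈q ; (there y∈L) → L⊆q y∈L }

walk-exit : ∀ {A : Set} {R : A → A → Set} (P : A → Set) → (∀ x → Dec (P x)) →
            ∀ {x y} → Star R x y → P x → ¬ P y → ∃ λ u → ∃ λ w → R u w × P u × ¬ P w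
walk-exit P P? ε                  px ¬py = ⊥-elim (¬py px)
walk-exit P P? (_◅_ {j = z} xz zy) px ¬py with P? z
... | yes pz = walk-exit P P? zy pz ¬py
... | no ¬pz = _ , z , xz , px , ¬pz

a+[2+b]≡2+[a+b] : ∀ a b → a + (2 + b) ≡ 2 + (a + b)
a+[2+b]≡2+[a+b] a b = trans (+-suc a (suc b)) (cong suc (+-suc a b))

-- Arithmetic of a greedy step that adds one vertex and colours c′ ≥ 2 + c vertices.
fuel-decreases : ∀ {n fuel c c′} → n ≤ suc fuel + c → 2 + c ≤ c′ → n ≤ fuel + c′
fuel-decreases {fuel = fuel} {c} enough grows =
  ≤-trans enough (≤-trans (≤-reflexive (≡-sym (+-suc fuel c))) (+-monoʳ-≤ fuel (≤-trans (n≤1+n _) grows)))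

greedy-account : ∀ {n a c c′ l} → a + c′ ≤ n + 2 * suc l → 2 + c ≤ c′ → a + c ≤ n + 2 * l
greedy-account {n} {a} {c} {c′} {l} bound grows = +-cancelˡ-≤ 2 (a + c) (n + 2 * l) (begin
  2 + (a + c)       ≡⟨ a+[2+b]≡2+[a+b] a c ⟨
  a + (2 + c)       ≤⟨ +-monoʳ-≤ a grows ⟩
  a + c′            ≤⟨ bound ⟩
  n + 2 * suc l     ≡⟨ cong (n +_) (*-suc 2 l) ⟩
  n + (2 + 2 * l)   ≡⟨ a+[2+b]≡2+[a+b] n (2 * l) ⟩
  2 + (n + 2 * l)   ∎)
  where open ≤-Reasoning

module _ {n : ℕ} (G : Graph n) where

  ColouredBy : List (Fin n) → Fin n → Set
  ColouredBy L = Colored G (fromList L)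

  coloured : List (Fin n) → Subset n
  coloured L = closure G (fromList L)

  -- L is anchored if each seed vertex has a coloured neighbour.  Then every coloured vertex has
  -- one (a forced vertex is adjacent to the vertex forcing it), which is what a greedy step needs.
  Anchored : List (Fin n) → Set
  Anchored L = All (λ v → ∃ λ t → Adj G v t × ColouredBy L t) L

  coloured-neighbour : ∀ {L} → Anchored L → ∀ {v} → ColouredBy L v → ∃ λ t → Adj G v t × ColouredBy L t
  coloured-neighbour anchored (initial v∈)     = All.lookup anchored (∈-fromList⁻ v∈)
  coloured-neighbour anchored (force cu uv _) = _ , adj-sym G uv , cu

  anchored-∷ : ∀ {L w t} → Adj G w t → ColouredBy (w ∷ L) t → Anchored L → Anchored (w ∷ L)
  anchored-∷ {L} {w} wt ct anchored =
    (_ , wt , ct) ∷ All.map (λ (t′ , vt′ , ct′) → t′ , vt′ , colored-mono (fromList-⊆∷ w L) ct′) anchored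

  -- Walk from the seed
  -- to an uncoloured vertex; where the walk leaves the coloured set, a coloured u with a coloured
  -- neighbour t has two uncoloured neighbours w₁ w₂; adding w₁ makes u force w₂.
  greedy-step : Cubic G → Connected G → ∀ {L x₀} → x₀ ∈ₗ L → Anchored L → ¬ ForcingSet G (fromList L) →
                ∃ λ w → Anchored (w ∷ L) × 2 + ∣ coloured L ∣ ≤ ∣ coloured (w ∷ L) ∣
  greedy-step cubic (_ , walk) {L} {x₀} x₀∈L anchored not-forcing
    with v , ¬cv ← ¬∀⟶∃¬ n (ColouredBy L) (colored? G (fromList L)) not-forcing
    with u , w , uw , cu , ¬cw ← walk-exit (ColouredBy L) (colored? G (fromList L)) (walk x₀ v)
                                   (initial (∈-fromList⁺ x₀∈L)) ¬cv
    with t , ut , ct ← coloured-neighbour anchored cu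
    with w₁ , w₂ , N ← nbhd-with₁ (proj₂ (proj₂ (proj₂ (cubic-nbhd G cubic u)))) ut =
    w₁ , anchored-∷ (adj-sym G (Nbhd.vb N)) (mono cu) anchored , grows
    where
    w∈ : w ≡ w₁ ⊎ w ≡ w₂
    w∈ with Nbhd.only N w uw
    ... | inj₁ refl = ⊥-elim (¬cw ct)
    ... | inj₂ w∈   = w∈
    ¬c₁ : ¬ ColouredBy L w₁
    ¬c₁ c₁ = ¬cw ([ (λ { refl → c₁ }) , (λ { refl → force-third N ct c₁ cu }) ]′ w∈)
    ¬c₂ : ¬ ColouredBy L w₂
    ¬c₂ c₂ = ¬cw ([ (λ { refl → force-third (nbhd-swap₂₃ N) ct c₂ cu }) , (λ { refl → c₂ }) ]′ w∈)
    mono : ∀ {x} → ColouredBy L x → ColouredBy (w₁ ∷ L) x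
    mono = colored-mono (fromList-⊆∷ w₁ L)
    c₁ : ColouredBy (w₁ ∷ L) w₁
    c₁ = initial (∈-fromList⁺ {L = w₁ ∷ L} (here refl))
    c₂ : ColouredBy (w₁ ∷ L) w₂
    c₂ = force-third N (mono ct) c₁ (mono cu)
    grows : 2 + ∣ coloured L ∣ ≤ ∣ coloured (w₁ ∷ L) ∣
    grows = distinct-count (w₁ ∷ w₂ ∷ []) (coloured L) (coloured (w₁ ∷ L)) ((Nbhd.b≢c N ∷ []) ∷ [] ∷ [])
      (λ { (here refl) → closure-complete G _ c₁ ; (there (here refl)) → closure-complete G _ c₂ })
      (λ { (here refl) c → ¬c₁ (closure-sound G _ c) ; (there (here refl)) c → ¬c₂ (closure-sound G _ c) })
      (λ c → closure-complete G _ (mono (closure-sound G _ c)))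

  -- The fuel bounds the number of uncoloured vertices.
  greedy : Cubic G → Connected G → ∀ fuel L {x₀} → x₀ ∈ₗ L → Anchored L → n ≤ fuel + ∣ coloured L ∣ →
           ∃ λ L′ → ForcingSet G (fromList L′) × 2 * length L′ + ∣ coloured L ∣ ≤ n + 2 * length L
  greedy cubic connected fuel L x₀∈L anchored enough with forcing? G (fromList L)
  ... | yes forcing =
    L , forcing , ≤-trans (+-monoʳ-≤ (2 * length L) (∣p∣≤n (coloured L))) (≤-reflexive (+-comm (2 * length L) n))
  ... | no not-forcing with greedy-step cubic connected x₀∈L anchored not-forcing | fuel
  ...   | w , anchored′ , grows | zero =
    ⊥-elim (not-forcing λ v → closure-sound G (fromList L)
                                 (subst (v ∈_) (≡-sym (∣p∣≡n⇒p≡⊤ (≤-antisym (∣p∣≤n (coloured L)) enough))) ∈⊤))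
  ...   | w , anchored′ , grows | suc fuel′
    with L′ , forcing , bound ← greedy cubic connected fuel′ (w ∷ L) (there x₀∈L) anchored′
                                  (fuel-decreases enough grows) =
    L′ , forcing , greedy-account bound grows

  Seed : Set
  Seed = ∃ λ L → ∃ λ x₀ → x₀ ∈ₗ L × Anchored L × 2 * length L < ∣ coloured L ∣

  seed⇒2F<n : Cubic G → Connected G → Seed → ∀ {k} → IsForcingNumber G k → 2 * k < n
  seed⇒2F<n cubic connected (L , x₀ , x₀∈L , anchored , many) {k} (_ , minimal)
    with L′ , forcing , bound ← greedy cubic connected n L x₀∈L anchored (m≤m+n n _) = begin-strict
      2 * k               ≤⟨ *-monoʳ-≤ 2 (≤-trans (minimal _ forcing) (∣fromList∣≤length L′)) ⟩
      2 * length L′       <⟨ +-cancelʳ-< (2 * length L) (2 * length L′) n (begin-strict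
        2 * length L′ + 2 * length L  <⟨ +-monoʳ-< (2 * length L′) many ⟩
        2 * length L′ + ∣ coloured L ∣ ≤⟨ bound ⟩
        n + 2 * length L              ∎) ⟩
      n                   ∎
    where open ≤-Reasoning

cubic-nbhd-of : ∀ {n} {G : Graph n} → Cubic G → ∀ {v a b c} → Adj G v a → Adj G v b → Adj G v c →
                a ≢ b → a ≢ c → b ≢ c → Nbhd G v a b c
cubic-nbhd-of {G = G} cubic {v} va vb vc a≢b a≢c b≢c
  with d , N ← nbhd-with₂ (proj₂ (proj₂ (proj₂ (cubic-nbhd G cubic v)))) va vb a≢b
  with Nbhd.only N _ vc
... | inj₁ c≡a        = ⊥-elim (a≢c (≡-sym c≡a))
... | inj₂ (inj₁ c≡b) = ⊥-elim (b≢c (≡-sym c≡b))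
... | inj₂ (inj₂ refl) = N

-- Colourings transfer along a map f that preserves and reflects adjacency and has a right
-- inverse g: the neighbours of f u are exactly the images of the neighbours of u.
module Transfer {n m : ℕ} (G : Graph n) (H : Graph m) (f : Fin n → Fin m) (g : Fin m → Fin n)
                (f∘g : ∀ y → f (g y) ≡ y) (adj≡ : ∀ u v → adj G u v ≡ adj H (f u) (f v)) where

  colored-image : ∀ {S S′} → (∀ {x} → x ∈ S → f x ∈ S′) → ∀ {x} → Colored G S x → Colored H S′ (f x)
  colored-image S→S′ (initial x∈S) = initial (S→S′ x∈S)
  colored-image {S} {S′} S→S′ (force {u} {w} cu uw others) =
    force (colored-image S→S′ cu) (subst T (adj≡ u w) uw) λ y fu~y y≢fw →
      subst (Colored H S′) (f∘g y) (colored-image S→S′ (others (g y)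
        (subst T (≡-sym (trans (adj≡ u (g y)) (cong (adj H (f u)) (f∘g y)))) fu~y)
        (λ gy≡w → y≢fw (trans (≡-sym (f∘g y)) (cong f gy≡w)))))

  forcing-image : ∀ S → ForcingSet G S → ∃ λ S′ → ForcingSet H S′ × ∣ S′ ∣ ≤ ∣ S ∣
  forcing-image S forcing with L , length≡ , listed ← members S =
    fromList (map f L) ,
    (λ y → subst (Colored H _) (f∘g y) (colored-image (λ x∈S → ∈-fromList⁺ (∈-map⁺ f (listed x∈S))) (forcing (g y)))) ,
    ≤-trans (∣fromList∣≤length (map f L)) (≤-reflexive (trans (length-map f L) length≡))

module Isomorphism {n m : ℕ} (G : Graph n) (H : Graph m) (iso : Isomorphic G (adj H)) where

  private
    f : Fin n → Fin m
    f = Bijection.to (proj₁ iso)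
    g : Fin m → Fin n
    g y = proj₁ (Bijection.surjective (proj₁ iso) y)
    f∘g : ∀ y → f (g y) ≡ y
    f∘g y = proj₂ (Bijection.surjective (proj₁ iso) y) refl
    g∘f : ∀ x → g (f x) ≡ x
    g∘f x = Bijection.injective (proj₁ iso) (f∘g (f x))
    adj≡ : ∀ u v → adj G u v ≡ adj H (f u) (f v)
    adj≡ = proj₂ iso
    adj≡′ : ∀ y z → adj H y z ≡ adj G (g y) (g z)
    adj≡′ y z = trans (cong₂ (adj H) (≡-sym (f∘g y)) (≡-sym (f∘g z))) (≡-sym (adj≡ (g y) (g z)))

  order≡ : n ≡ m
  order≡ = cantor-schröder-bernstein {f = f} {g = g} (Bijection.injective (proj₁ iso))
             (λ {y} {z} gy≡gz → trans (≡-sym (f∘g y)) (trans (cong f gy≡gz) (f∘g z)))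

  forcing-number≡ : ∀ {k k′} → IsForcingNumber G k → IsForcingNumber H k′ → k ≡ k′
  forcing-number≡ ((S , forcing , refl) , minimal) ((S′ , forcing′ , refl) , minimal′) =
    ≤-antisym (less G H g f g∘f adj≡′ minimal S′ forcing′) (less H G f g f∘g adj≡ minimal′ S forcing)
    where
    less : ∀ {p q} (A : Graph p) (B : Graph q) (φ : Fin q → Fin p) (ψ : Fin p → Fin q) →
           (∀ y → φ (ψ y) ≡ y) → (∀ u v → adj B u v ≡ adj A (φ u) (φ v)) →
           ∀ {k} → (∀ S → ForcingSet A S → k ≤ ∣ S ∣) → ∀ T → ForcingSet B T → k ≤ ∣ T ∣
    less A B φ ψ φ∘ψ adj≡ minimal T forcing with T′ , forcing′ , smaller ← Transfer.forcing-image B A φ ψ φ∘ψ adj≡ T forcing =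
      ≤-trans (minimal T′ forcing′) smaller

-- Each φ i has its three neighbours among the images of the three
-- H-neighbours of i, so the image is closed under adjacency (hence everything, by connectivity)
-- and non-edges of H go to non-edges of G.
module Recognise {n m : ℕ} (G : Graph n) (cubicG : Cubic G) (connected : Connected G)
                 (H : Graph m) (cubicH : Cubic H) (i₀ : Fin m)
                 (φ : Fin m → Fin n) (φ-injective : ∀ {i j} → φ i ≡ φ j → i ≡ j)
                 (φ-edge : ∀ {i j} → Adj H i j → Adj G (φ i) (φ j)) where

  image-nbhd : ∀ i → ∃ λ a → ∃ λ b → ∃ λ c → Nbhd H i a b c × Nbhd G (φ i) (φ a) (φ b) (φ c)
  image-nbhd i with a , b , c , N ← cubic-nbhd H cubicH i =
    a , b , c , N , cubic-nbhd-of cubicG (φ-edge (Nbhd.va N)) (φ-edge (Nbhd.vb N)) (φ-edge (Nbhd.vc N))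
                      (Nbhd.a≢b N ∘ φ-injective) (Nbhd.a≢c N ∘ φ-injective) (Nbhd.b≢c N ∘ φ-injective)

  image-closed : ∀ {i y} → Adj G (φ i) y → ∃ λ j → Adj H i j × φ j ≡ y
  image-closed {i} φi~y with a , b , c , N , Nφ ← image-nbhd i | Nbhd.only Nφ _ φi~y
  ... | inj₁ refl        = a , Nbhd.va N , refl
  ... | inj₂ (inj₁ refl) = b , Nbhd.vb N , refl
  ... | inj₂ (inj₂ refl) = c , Nbhd.vc N , refl

  in-image : ∀ {x y} → Star (Adj G) x y → ∃ (λ j → φ j ≡ x) → ∃ λ j → φ j ≡ y
  in-image ε                 x∈ = x∈
  in-image (φj~z ◅ walk) (j , refl) with k , _ , refl ← image-closed φj~z = in-image walk (k , refl)

  φ⁻¹ : Fin n → Fin m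
  φ⁻¹ y = proj₁ (in-image (proj₂ connected (φ i₀) y) (i₀ , refl))

  φ∘φ⁻¹ : ∀ y → φ (φ⁻¹ y) ≡ y
  φ∘φ⁻¹ y = proj₂ (in-image (proj₂ connected (φ i₀) y) (i₀ , refl))

  adj-image : ∀ i j → adj G (φ i) (φ j) ≡ adj H i j
  adj-image i j with adj H i j in Hij | adj G (φ i) (φ j) in Gij
  ... | true  | true  = refl
  ... | false | false = refl
  ... | true  | false = ⊥-elim (subst T Gij (φ-edge (subst T (≡-sym Hij) _)))
  ... | false | true with k , ik , φk≡φj ← image-closed (subst T (≡-sym Gij) _) =
    ⊥-elim (subst T Hij (subst (Adj H i) (φ-injective φk≡φj) ik))

  isomorphism : Isomorphic G (adj H)
  isomorphism =
    mk⤖ {to = φ⁻¹} ((λ {x} {y} eq → trans (≡-sym (φ∘φ⁻¹ x)) (trans (cong φ eq) (φ∘φ⁻¹ y))) ,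
                    (λ i → φ i , λ { refl → φ-injective (φ∘φ⁻¹ (φ i)) })) ,
    λ u v → trans (cong₂ (adj G) (≡-sym (φ∘φ⁻¹ u)) (≡-sym (φ∘φ⁻¹ v))) (adj-image (φ⁻¹ u) (φ⁻¹ v))

N2-edges : List (Fin 8 × Fin 8)
N2-edges = (# 0 , # 2) ∷ (# 0 , # 3) ∷ (# 1 , # 2) ∷ (# 1 , # 3) ∷ (# 2 , # 3)
         ∷ (# 4 , # 6) ∷ (# 4 , # 7) ∷ (# 5 , # 6) ∷ (# 5 , # 7) ∷ (# 6 , # 7)
         ∷ (# 0 , # 5) ∷ (# 4 , # 1) ∷ []

prism-edges : List (Fin 6 × Fin 6)
prism-edges = (# 0 , # 1) ∷ (# 1 , # 2) ∷ (# 0 , # 2)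
            ∷ (# 3 , # 4) ∷ (# 4 , # 5) ∷ (# 3 , # 5)
            ∷ (# 0 , # 3) ∷ (# 1 , # 4) ∷ (# 2 , # 5) ∷ []

K4-graph : Graph 4
K4-graph = record { adj = K4 ; sym = from-yes (all? λ u → all? λ v → K4 u v ≟ᵇ K4 v u)
                  ; irrefl = from-yes (all? λ v → K4 v v ≟ᵇ false) }

N2-graph : Graph 8
N2-graph = record { adj = N2 ; sym = from-yes (all? λ u → all? λ v → N2 u v ≟ᵇ N2 v u)
                  ; irrefl = from-yes (all? λ v → N2 v v ≟ᵇ false) }

prism-graph : Graph 6
prism-graph = record { adj = Prism ; sym = from-yes (all? λ u → all? λ v → Prism u v ≟ᵇ Prism v u)
                     ; irrefl = from-yes (all? λ v → Prism v v ≟ᵇ false) }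

K4-cubic : Cubic K4-graph
K4-cubic = from-yes (all? λ v → degree K4-graph v ≟ℕ 3)

N2-cubic : Cubic N2-graph
N2-cubic = from-yes (all? λ v → degree N2-graph v ≟ℕ 3)

prism-cubic : Cubic prism-graph
prism-cubic = from-yes (all? λ v → degree prism-graph v ≟ℕ 3)

minimum-forcing-set : ∀ {m} (H : Graph m) (S : Subset m) → ForcingSet H S →
                      ¬ (∃ λ S′ → ∣ S′ ∣ < ∣ S ∣ × ForcingSet H S′) → IsForcingNumber H ∣ S ∣
minimum-forcing-set H S forcing none =
  (S , forcing , refl) , λ S′ forcing′ → ≮⇒≥ (λ smaller → none (S′ , smaller , forcing′))

N2-forcing-number : IsForcingNumber N2-graph 4
N2-forcing-number = minimum-forcing-set N2-graph S
  (from-yes (forcing? N2-graph S)) (from-no (anySubset? λ S′ → (∣ S′ ∣ <? 4) ×-dec forcing? N2-graph S′))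
  where
  S : Subset 8
  S = fromList (# 0 ∷ # 1 ∷ # 2 ∷ # 6 ∷ [])

prism-forcing-number : IsForcingNumber prism-graph 3
prism-forcing-number = minimum-forcing-set prism-graph S
  (from-yes (forcing? prism-graph S)) (from-no (anySubset? λ S′ → (∣ S′ ∣ <? 3) ×-dec forcing? prism-graph S′))
  where
  S : Subset 6
  S = fromList (# 0 ∷ # 1 ∷ # 2 ∷ [])

extremal-iso : ∀ {n m} (G : Graph n) (H : Graph m) {k₀} → IsForcingNumber H k₀ → 2 * k₀ ≡ m →
               Isomorphic G (adj H) → ∀ {k} → IsForcingNumber G k → 2 * k ≡ n
extremal-iso G H F-H extremal iso F-G =
  trans (cong (2 *_) (Isomorphism.forcing-number≡ G H iso F-G F-H)) (trans extremal (≡-sym (Isomorphism.order≡ G H iso)))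

lookup-injective : ∀ {A : Set} (V : List A) → Unique V → ∀ {i j} → lookup V i ≡ lookup V j → i ≡ j
lookup-injective (x ∷ V) (x∉V ∷ unique) {fzero}  {fzero}  _   = refl
lookup-injective (x ∷ V) (x∉V ∷ unique) {fzero}  {fsuc j} x≡  = ⊥-elim (All.lookup x∉V (∈-lookup j) x≡)
lookup-injective (x ∷ V) (x∉V ∷ unique) {fsuc i} {fzero}  ≡x  = ⊥-elim (All.lookup x∉V (∈-lookup i) (≡-sym ≡x))
lookup-injective (x ∷ V) (x∉V ∷ unique) {fsuc i} {fsuc j} eq  = cong fsuc (lookup-injective V unique eq)

Realised : ∀ {n m} (G : Graph n) (φ : Fin m → Fin n) → List (Fin m × Fin m) → Set
Realised G φ es = All (λ (a , b) → Adj G (φ a) (φ b)) es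

edge-match : ∀ {m} {a b i j : Fin m} → T ((⌊ a ≟ i ⌋ ∧ ⌊ b ≟ j ⌋) ∨ (⌊ a ≟ j ⌋ ∧ ⌊ b ≟ i ⌋)) →
             (a ≡ i × b ≡ j) ⊎ (a ≡ j × b ≡ i)
edge-match {a = a} {b} {i} {j} match with Equivalence.to T-∨ match
... | inj₁ both = inj₁ (toWitness {a? = a ≟ i} (proj₁ (Equivalence.to T-∧ both)) ,
                        toWitness {a? = b ≟ j} (proj₂ (Equivalence.to T-∧ both)))
... | inj₂ both = inj₂ (toWitness {a? = a ≟ j} (proj₁ (Equivalence.to T-∧ both)) ,
                        toWitness {a? = b ≟ i} (proj₂ (Equivalence.to T-∧ both)))

realised-adj : ∀ {n m} (G : Graph n) (φ : Fin m → Fin n) (es : List (Fin m × Fin m)) → Realised G φ es →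
               ∀ {i j} → T (fromEdges es i j) → Adj G (φ i) (φ j)
realised-adj G φ ((a , b) ∷ es) (ab ∷ realised) edge with any⁻ _ ((a , b) ∷ es) edge
... | there listed = realised-adj G φ es realised (any⁺ _ listed)
... | here match with edge-match {a = a} {b} match
...   | inj₁ (refl , refl) = ab
...   | inj₂ (refl , refl) = adj-sym G ab

module Local {n : ℕ} (G : Graph n) (cubic : Cubic G) where

  -- Colours L x: x is coloured from the seed list L (a record, so that L can be inferred).
  record Colours (L : List (Fin n)) (x : Fin n) : Set where
    constructor colours
    field colouring : ColouredBy G L x
  open Colours public

  initially : ∀ {L x} → x ∈ₗ L → Colours L x
  initially x∈L = colours (initial (∈-fromList⁺ x∈L))

  forced : ∀ {L u a b w} → Nbhd G u a b w → Colours L a → Colours L b → Colours L u → Colours L w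
  forced N (colours ca) (colours cb) (colours cu) = colours (force-third N ca cb cu)

  extend : ∀ {L} w {x} → Colours L x → Colours (w ∷ L) x
  extend {L} w (colours c) = colours (colored-mono (fromList-⊆∷ w L) c)

  -- Neighbourhoods containing one or two prescribed neighbours.  They are kept abstract: the
  -- remaining neighbours are only ever used through the Nbhd property.
  abstract
    nbhd₁ : ∀ {v x} → Adj G v x → ∃ λ y → ∃ λ z → Nbhd G v x y z
    nbhd₁ {v} = nbhd-with₁ (proj₂ (proj₂ (proj₂ (cubic-nbhd G cubic v))))

    nbhd₂ : ∀ {v x y} → Adj G v x → Adj G v y → x ≢ y → ∃ λ z → Nbhd G v x y z
    nbhd₂ {v} = nbhd-with₂ (proj₂ (proj₂ (proj₂ (cubic-nbhd G cubic v))))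

  claw-edge : ClawFree G → ∀ {v a b c} → Nbhd G v a b c → Adj G a b ⊎ Adj G a c ⊎ Adj G b c
  claw-edge claw-free {v} {a} {b} {c} N with Adj? G a b | Adj? G a c | Adj? G b c
  ... | yes ab | _      | _      = inj₁ ab
  ... | no _   | yes ac | _      = inj₂ (inj₁ ac)
  ... | no _   | no _   | yes bc = inj₂ (inj₂ bc)
  ... | no ¬ab | no ¬ac | no ¬bc =
    ⊥-elim (claw-free v a b c
      (Nbhd.va N , Nbhd.vb N , Nbhd.vc N , Nbhd.a≢b N , Nbhd.a≢c N , Nbhd.b≢c N , ¬ab , ¬ac , ¬bc))

  claw-pair : ClawFree G → ∀ {v a s t} → Nbhd G v a s t → ¬ Adj G a s → ¬ Adj G a t → Adj G s t
  claw-pair claw-free N ¬as ¬at with claw-edge claw-free N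
  ... | inj₁ as        = ⊥-elim (¬as as)
  ... | inj₂ (inj₁ at) = ⊥-elim (¬at at)
  ... | inj₂ (inj₂ st) = st

  seed-from : ∀ L {x₀} → x₀ ∈ₗ L → Anchored G L → ∀ D → Unique D → All (Colours L) D →
              2 * length L < length D → Seed G
  seed-from L x₀∈L anchored D unique coloured-D longer =
    L , _ , x₀∈L , anchored ,
    ≤-trans longer (distinct-length≤ D (coloured G L) unique
                     (λ x∈D → closure-complete G _ (colouring (All.lookup coloured-D x∈D))))

  seed-or-exact : ∀ L {x₀} → x₀ ∈ₗ L → Anchored G L → ∀ D → Unique D → All (Colours L) D →
                  length D ≡ 2 * length L → Seed G ⊎ (∀ {x} → Colours L x → x ∈ₗ D)
  seed-or-exact L x₀∈L anchored D unique coloured-D length≡ with 2 * length L <? ∣ coloured G L ∣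
  ... | yes more = inj₁ (L , _ , x₀∈L , anchored , more)
  ... | no ¬more = inj₂ λ x → distinct-exhaustive D (coloured G L) unique
          (λ y∈D → closure-complete G _ (colouring (All.lookup coloured-D y∈D)))
          (≤-trans (≮⇒≥ ¬more) (≤-reflexive (≡-sym length≡))) (closure-complete G _ (colouring x))

-- The seed [a, c, d] colours D₀ = {a, b, c, d, a', b'}, where a', b' are the
-- outer neighbours of a and b.  Unless that already is a Seed, D₀ is all it colours; the other
-- neighbours s ~ t of a' (an edge, by claw-freeness) are then new, and adding s colours s, t and
-- their third neighbours s', t'.  Either one of s', t' is new (nine coloured vertices from four
-- seeds: a Seed), or s' = t' = b' and the eight vertices form the diamond-necklace N2.
module Diamond {n : ℕ} (G : Graph n) (cubic : Cubic G) (connected : Connected G) (claw-free : ClawFree G)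
  {a b c d : Fin n} (Nc : Nbhd G c a b d) (Nd : Nbhd G d a b c) (a≁b : ¬ Adj G a b) where
  open Local G cubic

  a~c : Adj G a c
  a~c = adj-sym G (Nbhd.va Nc)
  a~d : Adj G a d
  a~d = adj-sym G (Nbhd.va Nd)
  b~c : Adj G b c
  b~c = adj-sym G (Nbhd.vb Nc)
  b~d : Adj G b d
  b~d = adj-sym G (Nbhd.vb Nd)
  c~d : Adj G c d
  c~d = Nbhd.vc Nc

  a≢b : a ≢ b
  a≢b = Nbhd.a≢b Nc
  a≢c : a ≢ c
  a≢c = adj⇒≢ G a~c
  a≢d : a ≢ d
  a≢d = adj⇒≢ G a~d
  b≢c : b ≢ c
  b≢c = adj⇒≢ G b~c
  b≢d : b ≢ d
  b≢d = adj⇒≢ G b~d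
  c≢d : c ≢ d
  c≢d = adj⇒≢ G c~d

  a' : Fin n
  a' = proj₁ (nbhd₂ a~c a~d c≢d)
  Na : Nbhd G a c d a'
  Na = proj₂ (nbhd₂ a~c a~d c≢d)
  b' : Fin n
  b' = proj₁ (nbhd₂ b~c b~d c≢d)
  Nb : Nbhd G b c d b'
  Nb = proj₂ (nbhd₂ b~c b~d c≢d)

  a~a' : Adj G a a'
  a~a' = Nbhd.vc Na
  b~b' : Adj G b b'
  b~b' = Nbhd.vc Nb

  a≢a' : a ≢ a'
  a≢a' = adj⇒≢ G a~a'
  b≢b' : b ≢ b'
  b≢b' = adj⇒≢ G b~b'
  c≢a' : c ≢ a'
  c≢a' = Nbhd.a≢c Na
  d≢a' : d ≢ a'
  d≢a' = Nbhd.b≢c Na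
  c≢b' : c ≢ b'
  c≢b' = Nbhd.a≢c Nb
  d≢b' : d ≢ b'
  d≢b' = Nbhd.b≢c Nb
  b≢a' : b ≢ a'
  b≢a' b≡a' = a≁b (subst (Adj G a) (≡-sym b≡a') a~a')
  a≢b' : a ≢ b'
  a≢b' a≡b' = a≁b (adj-sym G (subst (Adj G b) (≡-sym a≡b') b~b'))

  c≁a' : ¬ Adj G c a'
  c≁a' = not-adj Nc (≢-sym a≢a') (≢-sym b≢a') (≢-sym d≢a')
  d≁a' : ¬ Adj G d a'
  d≁a' = not-adj Nd (≢-sym a≢a') (≢-sym b≢a') (≢-sym c≢a')

  -- a' ≠ b': otherwise the third neighbour e of a' = b' would be adjacent to a or b (claw-freeness),
  -- i.e. would lie in {c, d}, but c and d are not adjacent to a'.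
  a'≢b' : a' ≢ b'
  a'≢b' a'≡b' with nbhd₂ (adj-sym G a~a') (adj-sym G (subst (Adj G b) (≡-sym a'≡b') b~b')) a≢b
  ... | e , Ne with claw-edge claw-free Ne
  ...   | inj₁ a~b = a≁b a~b
  ...   | inj₂ (inj₁ a~e) with Nbhd.only Na e a~e
  ...     | inj₁ refl        = c≁a' (adj-sym G (Nbhd.vc Ne))
  ...     | inj₂ (inj₁ refl) = d≁a' (adj-sym G (Nbhd.vc Ne))
  ...     | inj₂ (inj₂ refl) = adj⇒≢ G (Nbhd.vc Ne) refl
  a'≢b' a'≡b' | e , Ne | inj₂ (inj₂ b~e) with Nbhd.only Nb e b~e
  ...     | inj₁ refl        = c≁a' (adj-sym G (Nbhd.vc Ne))
  ...     | inj₂ (inj₁ refl) = d≁a' (adj-sym G (Nbhd.vc Ne))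
  ...     | inj₂ (inj₂ refl) = adj⇒≢ G (Nbhd.vc Ne) a'≡b'

  D₀ : List (Fin n)
  D₀ = a ∷ b ∷ c ∷ d ∷ a' ∷ b' ∷ []

  D₀-distinct : Unique D₀
  D₀-distinct = (a≢b ∷ a≢c ∷ a≢d ∷ a≢a' ∷ a≢b' ∷ []) ∷ (b≢c ∷ b≢d ∷ b≢a' ∷ b≢b' ∷ []) ∷
                (c≢d ∷ c≢a' ∷ c≢b' ∷ []) ∷ (d≢a' ∷ d≢b' ∷ []) ∷ (a'≢b' ∷ []) ∷ [] ∷ []

  L₀ : List (Fin n)
  L₀ = a ∷ c ∷ d ∷ []

  ca : Colours L₀ a
  ca = initially (here refl)
  cc : Colours L₀ c
  cc = initially (there (here refl))
  cd : Colours L₀ d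
  cd = initially (there (there (here refl)))
  cb : Colours L₀ b
  cb = forced (nbhd-swap₂₃ Nc) ca cd cc
  ca' : Colours L₀ a'
  ca' = forced Na cc cd ca
  cb' : Colours L₀ b'
  cb' = forced Nb cc cd cb

  L₀-anchored : Anchored G L₀
  L₀-anchored = (c , a~c , colouring cc) ∷ (a , adj-sym G a~c , colouring ca) ∷ (a , adj-sym G a~d , colouring ca) ∷ []

  D₀-coloured : All (Colours L₀) D₀
  D₀-coloured = ca ∷ cb ∷ cc ∷ cd ∷ ca' ∷ cb' ∷ []

  s : Fin n
  s = proj₁ (nbhd₁ (adj-sym G a~a'))
  t : Fin n
  t = proj₁ (proj₂ (nbhd₁ (adj-sym G a~a')))
  Na' : Nbhd G a' a s t
  Na' = proj₂ (proj₂ (nbhd₁ (adj-sym G a~a')))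

  module Outer (y : Fin n) (a'~y : Adj G a' y) (y≢a : y ≢ a) where
    y≢a' : y ≢ a'
    y≢a' = ≢-sym (adj⇒≢ G a'~y)
    y≢c : y ≢ c
    y≢c y≡c = c≁a' (adj-sym G (subst (Adj G a') y≡c a'~y))
    y≢d : y ≢ d
    y≢d y≡d = d≁a' (adj-sym G (subst (Adj G a') y≡d a'~y))
    y≢b : y ≢ b
    y≢b y≡b = not-adj Nb (≢-sym c≢a') (≢-sym d≢a') a'≢b' (adj-sym G (subst (Adj G a') y≡b a'~y))
    a≁y : ¬ Adj G a y
    a≁y = not-adj Na y≢c y≢d y≢a'

  module Os = Outer s (Nbhd.vb Na') (≢-sym (Nbhd.a≢b Na'))
  module Ot = Outer t (Nbhd.vc Na') (≢-sym (Nbhd.a≢c Na'))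

  s~t : Adj G s t
  s~t = claw-pair claw-free Na' Os.a≁y Ot.a≁y

  s≢t : s ≢ t
  s≢t = Nbhd.b≢c Na'

  s∉D₀ : s ≢ b' → All (s ≢_) D₀
  s∉D₀ s≢b' = ≢-sym (Nbhd.a≢b Na') ∷ Os.y≢b ∷ Os.y≢c ∷ Os.y≢d ∷ Os.y≢a' ∷ s≢b' ∷ []
  t∉D₀ : t ≢ b' → All (t ≢_) D₀
  t∉D₀ t≢b' = ≢-sym (Nbhd.a≢c Na') ∷ Ot.y≢b ∷ Ot.y≢c ∷ Ot.y≢d ∷ Ot.y≢a' ∷ t≢b' ∷ []

  -- A vertex z adjacent to some y ∉ D₀ lies outside D₀ unless z ∈ {a', b'}: the other vertices of
  -- D₀ have all their neighbours in D₀.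
  next∉D₀ : ∀ {y z} → All (y ≢_) D₀ → Adj G y z → z ≢ a' → z ≢ b' → All (z ≢_) D₀
  next∉D₀ {y} (y≢a ∷ y≢b ∷ y≢c ∷ y≢d ∷ y≢a' ∷ y≢b' ∷ []) y~z z≢a' z≢b' =
    (λ { refl → not-adj Na y≢c y≢d y≢a' (adj-sym G y~z) }) ∷
    (λ { refl → not-adj Nb y≢c y≢d y≢b' (adj-sym G y~z) }) ∷
    (λ { refl → not-adj Nc y≢a y≢b y≢d (adj-sym G y~z) }) ∷
    (λ { refl → not-adj Nd y≢a y≢b y≢c (adj-sym G y~z) }) ∷ z≢a' ∷ z≢b' ∷ []

  module Exact (exact : ∀ {x} → Colours L₀ x → x ∈ₗ D₀) where
    -- s = b' would make a' force t ∉ D₀, and symmetrically.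
    s≢b' : s ≢ b'
    s≢b' s≡b' = All¬⇒¬Any (t∉D₀ (λ t≡b' → s≢t (trans s≡b' (≡-sym t≡b'))))
                  (exact (forced Na' ca (subst (Colours L₀) (≡-sym s≡b') cb') ca'))
    t≢b' : t ≢ b'
    t≢b' t≡b' = All¬⇒¬Any (s∉D₀ (λ s≡b' → s≢t (trans s≡b' (≡-sym t≡b'))))
                  (exact (forced (nbhd-swap₂₃ Na') ca (subst (Colours L₀) (≡-sym t≡b') cb') ca'))

    s-out : All (s ≢_) D₀
    s-out = s∉D₀ s≢b'
    t-out : All (t ≢_) D₀
    t-out = t∉D₀ t≢b'

    L₁ : List (Fin n)
    L₁ = s ∷ L₀
    cs₁ : Colours L₁ s
    cs₁ = initially (here refl)
    ct₁ : Colours L₁ t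
    ct₁ = forced Na' (extend s ca) cs₁ (extend s ca')
    L₁-anchored : Anchored G L₁
    L₁-anchored = anchored-∷ G (adj-sym G (Nbhd.vb Na')) (colouring (extend s ca')) L₀-anchored
    D₀-coloured₁ : All (Colours L₁) D₀
    D₀-coloured₁ = All.map (extend s) D₀-coloured

    s' : Fin n
    s' = proj₁ (nbhd₂ (adj-sym G (Nbhd.vb Na')) s~t (adj⇒≢ G (Nbhd.vc Na')))
    Ns : Nbhd G s a' t s'
    Ns = proj₂ (nbhd₂ (adj-sym G (Nbhd.vb Na')) s~t (adj⇒≢ G (Nbhd.vc Na')))
    t' : Fin n
    t' = proj₁ (nbhd₂ (adj-sym G (Nbhd.vc Na')) (adj-sym G s~t) (adj⇒≢ G (Nbhd.vb Na')))
    Nt : Nbhd G t a' s t'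
    Nt = proj₂ (nbhd₂ (adj-sym G (Nbhd.vc Na')) (adj-sym G s~t) (adj⇒≢ G (Nbhd.vb Na')))
    cs' : Colours L₁ s'
    cs' = forced Ns (extend s ca') ct₁ cs₁
    ct' : Colours L₁ t'
    ct' = forced Nt (extend s ca') cs₁ ct₁

    -- The necklace: a b c d form the first diamond, b' a' s t the second.
    V : List (Fin n)
    V = a ∷ b ∷ c ∷ d ∷ b' ∷ a' ∷ s ∷ t ∷ []

    V-distinct : Unique V
    V-distinct =
      (a≢b ∷ a≢c ∷ a≢d ∷ a≢b' ∷ a≢a' ∷ ≢-sym (All.lookup s-out (here refl)) ∷ ≢-sym (All.lookup t-out (here refl)) ∷ []) ∷
      (b≢c ∷ b≢d ∷ b≢b' ∷ b≢a' ∷ ≢-sym Os.y≢b ∷ ≢-sym Ot.y≢b ∷ []) ∷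
      (c≢d ∷ c≢b' ∷ c≢a' ∷ ≢-sym Os.y≢c ∷ ≢-sym Ot.y≢c ∷ []) ∷
      (d≢b' ∷ d≢a' ∷ ≢-sym Os.y≢d ∷ ≢-sym Ot.y≢d ∷ []) ∷
      (≢-sym a'≢b' ∷ ≢-sym s≢b' ∷ ≢-sym t≢b' ∷ []) ∷
      (≢-sym Os.y≢a' ∷ ≢-sym Ot.y≢a' ∷ []) ∷
      (s≢t ∷ []) ∷ [] ∷ []

    necklace : s' ≡ b' → t' ≡ b' → Isomorphic G N2
    necklace s'≡b' t'≡b' = Recognise.isomorphism G cubic connected N2-graph N2-cubic fzero (lookup V)
      (lookup-injective V V-distinct) λ {i} {j} → realised-adj G (lookup V) N2-edges
        (a~c ∷ a~d ∷ b~c ∷ b~d ∷ c~d ∷ subst (λ z → Adj G z s) s'≡b' (adj-sym G (Nbhd.vc Ns)) ∷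
         subst (λ z → Adj G z t) t'≡b' (adj-sym G (Nbhd.vc Nt)) ∷
         Nbhd.vb Na' ∷ Nbhd.vc Na' ∷ s~t ∷ a~a' ∷ adj-sym G b~b' ∷ []) {i} {j}

    seed-or-necklace : Seed G ⊎ Isomorphic G N2
    seed-or-necklace with s' ≟ b' | t' ≟ b'
    ... | no s'≢b' | _ = inj₁ (seed-from L₁ (here refl) L₁-anchored (s' ∷ s ∷ t ∷ D₀)
           ((≢-sym (adj⇒≢ G (Nbhd.vc Ns)) ∷ ≢-sym (Nbhd.b≢c Ns) ∷
             next∉D₀ s-out (Nbhd.vc Ns) (≢-sym (Nbhd.a≢c Ns)) s'≢b') ∷ (s≢t ∷ s-out) ∷ t-out ∷ D₀-distinct)
           (cs' ∷ cs₁ ∷ ct₁ ∷ D₀-coloured₁) ≤-refl)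
    ... | yes _ | no t'≢b' = inj₁ (seed-from L₁ (here refl) L₁-anchored (t' ∷ s ∷ t ∷ D₀)
           ((≢-sym (Nbhd.b≢c Nt) ∷ ≢-sym (adj⇒≢ G (Nbhd.vc Nt)) ∷
             next∉D₀ t-out (Nbhd.vc Nt) (≢-sym (Nbhd.a≢c Nt)) t'≢b') ∷ (s≢t ∷ s-out) ∷ t-out ∷ D₀-distinct)
           (ct' ∷ cs₁ ∷ ct₁ ∷ D₀-coloured₁) ≤-refl)
    ... | yes s'≡b' | yes t'≡b' = inj₂ (necklace s'≡b' t'≡b')

  seed-or-necklace : Seed G ⊎ Isomorphic G N2
  seed-or-necklace with seed-or-exact L₀ (here refl) L₀-anchored D₀ D₀-distinct D₀-coloured refl
  ... | inj₁ seed  = inj₁ seed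
  ... | inj₂ exact = Exact.seed-or-necklace exact

module TriangleBasics {n : ℕ} (G : Graph n) (cubic : Cubic G) (claw-free : ClawFree G)
  {x y z x' y' z' : Fin n} (Nx : Nbhd G x y z x') (Ny : Nbhd G y x z y') (Nz : Nbhd G z x y z')
  (x'≢y' : x' ≢ y') (x'≢z' : x' ≢ z') (y'≢z' : y' ≢ z') where
  open Local G cubic

  x~y : Adj G x y
  x~y = Nbhd.va Nx
  x~z : Adj G x z
  x~z = Nbhd.vb Nx
  y~z : Adj G y z
  y~z = Nbhd.vb Ny
  x≢y : x ≢ y
  x≢y = adj⇒≢ G x~y
  x≢z : x ≢ z
  x≢z = adj⇒≢ G x~z
  y≢z : y ≢ z
  y≢z = adj⇒≢ G y~z
  x≢x' : x ≢ x'
  x≢x' = adj⇒≢ G (Nbhd.vc Nx)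
  y≢x' : y ≢ x'
  y≢x' = Nbhd.a≢c Nx
  z≢x' : z ≢ x'
  z≢x' = Nbhd.b≢c Nx
  y≢y' : y ≢ y'
  y≢y' = adj⇒≢ G (Nbhd.vc Ny)
  x≢y' : x ≢ y'
  x≢y' = Nbhd.a≢c Ny
  z≢y' : z ≢ y'
  z≢y' = Nbhd.b≢c Ny
  z≢z' : z ≢ z'
  z≢z' = adj⇒≢ G (Nbhd.vc Nz)
  x≢z' : x ≢ z'
  x≢z' = Nbhd.a≢c Nz
  y≢z' : y ≢ z'
  y≢z' = Nbhd.b≢c Nz

  D₀ : List (Fin n)
  D₀ = x ∷ y ∷ z ∷ x' ∷ y' ∷ z' ∷ []

  D₀-distinct : Unique D₀
  D₀-distinct = (x≢y ∷ x≢z ∷ x≢x' ∷ x≢y' ∷ x≢z' ∷ []) ∷ (y≢z ∷ y≢x' ∷ y≢y' ∷ y≢z' ∷ []) ∷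
                (z≢x' ∷ z≢y' ∷ z≢z' ∷ []) ∷ (x'≢y' ∷ x'≢z' ∷ []) ∷ (y'≢z' ∷ []) ∷ [] ∷ []

  L₀ : List (Fin n)
  L₀ = x ∷ y ∷ z ∷ []

  cx : Colours L₀ x
  cx = initially (here refl)
  cy : Colours L₀ y
  cy = initially (there (here refl))
  cz : Colours L₀ z
  cz = initially (there (there (here refl)))
  cx' : Colours L₀ x'
  cx' = forced Nx cy cz cx
  cy' : Colours L₀ y'
  cy' = forced Ny cx cz cy
  cz' : Colours L₀ z'
  cz' = forced Nz cx cy cz

  D₀-coloured : All (Colours L₀) D₀
  D₀-coloured = cx ∷ cy ∷ cz ∷ cx' ∷ cy' ∷ cz' ∷ []

  L₀-anchored : Anchored G L₀
  L₀-anchored = (y , x~y , colouring cy) ∷ (x , adj-sym G x~y , colouring cx) ∷ (x , adj-sym G x~z , colouring cx) ∷ []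

  y≁x' : ¬ Adj G y x'
  y≁x' = not-adj Ny (≢-sym x≢x') (≢-sym z≢x') x'≢y'
  z≁x' : ¬ Adj G z x'
  z≁x' = not-adj Nz (≢-sym x≢x') (≢-sym y≢x') x'≢z'

  module Outer (w : Fin n) (x'~w : Adj G x' w) (x≢w : x ≢ w) where
    w≢x : w ≢ x
    w≢x = ≢-sym x≢w
    w≢x' : w ≢ x'
    w≢x' = ≢-sym (adj⇒≢ G x'~w)
    w≢y : w ≢ y
    w≢y w≡y = y≁x' (adj-sym G (subst (Adj G x') w≡y x'~w))
    w≢z : w ≢ z
    w≢z w≡z = z≁x' (adj-sym G (subst (Adj G x') w≡z x'~w))
    x≁w : ¬ Adj G x w
    x≁w = not-adj Nx w≢y w≢z w≢x'

  -- The seed [s, x, y, z] colours the eight vertices D₁ = {s, t} ∪ D₀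
  -- together with s' and t'; a ninth coloured vertex makes it a Seed.
  module Extended {s t s' t' : Fin n} (Nx' : Nbhd G x' x s t) (s~t : Adj G s t)
                  (Ns : Nbhd G s x' t s') (Nt : Nbhd G t x' s t')
                  (s≢y' : s ≢ y') (s≢z' : s ≢ z') (t≢y' : t ≢ y') (t≢z' : t ≢ z') where

    module Os = Outer s (Nbhd.vb Nx') (Nbhd.a≢b Nx')
    module Ot = Outer t (Nbhd.vc Nx') (Nbhd.a≢c Nx')

    s≢t : s ≢ t
    s≢t = Nbhd.b≢c Nx'

    s-out : All (s ≢_) D₀
    s-out = Os.w≢x ∷ Os.w≢y ∷ Os.w≢z ∷ Os.w≢x' ∷ s≢y' ∷ s≢z' ∷ []
    t-out : All (t ≢_) D₀
    t-out = Ot.w≢x ∷ Ot.w≢y ∷ Ot.w≢z ∷ Ot.w≢x' ∷ t≢y' ∷ t≢z' ∷ []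

    L₁ : List (Fin n)
    L₁ = s ∷ L₀
    cs : Colours L₁ s
    cs = initially (here refl)
    ct : Colours L₁ t
    ct = forced Nx' (extend s cx) cs (extend s cx')
    cs' : Colours L₁ s'
    cs' = forced Ns (extend s cx') ct cs
    ct' : Colours L₁ t'
    ct' = forced Nt (extend s cx') cs ct
    L₁-anchored : Anchored G L₁
    L₁-anchored = anchored-∷ G (adj-sym G (Nbhd.vb Nx')) (colouring (extend s cx')) L₀-anchored

    D₁ : List (Fin n)
    D₁ = s ∷ t ∷ D₀
    D₁-distinct : Unique D₁
    D₁-distinct = (s≢t ∷ s-out) ∷ t-out ∷ D₀-distinct
    D₁-coloured : All (Colours L₁) D₁
    D₁-coloured = cs ∷ ct ∷ All.map (extend s) D₀-coloured

    seed-with : ∀ {v} → Colours L₁ v → All (v ≢_) D₁ → Seed G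
    seed-with cv v-out = seed-from L₁ (here refl) L₁-anchored (_ ∷ D₁) (v-out ∷ D₁-distinct) (cv ∷ D₁-coloured) ≤-refl

    t'-out : t' ≢ y' → t' ≢ z' → All (t' ≢_) D₁
    t'-out t'≢y' t'≢z' = ≢-sym (Nbhd.b≢c Nt) ∷ ≢-sym (adj⇒≢ G (Nbhd.vc Nt)) ∷
      (λ t'≡x → not-adj Nx Ot.w≢y Ot.w≢z Ot.w≢x' (adj-sym G (subst (Adj G t) t'≡x (Nbhd.vc Nt)))) ∷
      (λ t'≡y → not-adj Ny Ot.w≢x Ot.w≢z t≢y' (adj-sym G (subst (Adj G t) t'≡y (Nbhd.vc Nt)))) ∷
      (λ t'≡z → not-adj Nz Ot.w≢x Ot.w≢y t≢z' (adj-sym G (subst (Adj G t) t'≡z (Nbhd.vc Nt)))) ∷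
      ≢-sym (Nbhd.a≢c Nt) ∷ t'≢y' ∷ t'≢z' ∷ []

    s'-out : s' ≢ y' → s' ≢ z' → All (s' ≢_) D₁
    s'-out s'≢y' s'≢z' = ≢-sym (adj⇒≢ G (Nbhd.vc Ns)) ∷ ≢-sym (Nbhd.b≢c Ns) ∷
      (λ s'≡x → not-adj Nx Os.w≢y Os.w≢z Os.w≢x' (adj-sym G (subst (Adj G s) s'≡x (Nbhd.vc Ns)))) ∷
      (λ s'≡y → not-adj Ny Os.w≢x Os.w≢z s≢y' (adj-sym G (subst (Adj G s) s'≡y (Nbhd.vc Ns)))) ∷
      (λ s'≡z → not-adj Nz Os.w≢x Os.w≢y s≢z' (adj-sym G (subst (Adj G s) s'≡z (Nbhd.vc Ns)))) ∷
      ≢-sym (Nbhd.a≢c Ns) ∷ s'≢y' ∷ s'≢z' ∷ []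

    -- The tail of the triangle case: s' = y'.  In every case some further vertex is coloured,
    -- possibly after adding one more seed vertex.
    module Tail (s'≡y' : s' ≡ y') where

      s~y' : Adj G s y'
      s~y' = subst (Adj G s) s'≡y' (Nbhd.vc Ns)

      z'≢s' : z' ≢ s'
      z'≢s' z'≡s' = y'≢z' (trans (≡-sym s'≡y') (≡-sym z'≡s'))

      -- If t' = y', then N(y') = {y, s, t}, and the neighbours u₁ ~ u₂ of z' other than z are new.
      -- Adding u₁ to the seed colours u₁, u₂ and the third neighbour w of u₁: eleven vertices
      -- from five seeds.
      module Closed (t'≡y' : t' ≡ y') where
        t~y' : Adj G t y'
        t~y' = subst (Adj G t) t'≡y' (Nbhd.vc Nt)
        Ny'′ : Nbhd G y' y s t
        Ny'′ = cubic-nbhd-of cubic (adj-sym G (Nbhd.vc Ny)) (adj-sym G s~y') (adj-sym G t~y')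
                 (≢-sym Os.w≢y) (≢-sym Ot.w≢y) s≢t

        x≁z' : ¬ Adj G x z'
        x≁z' = not-adj Nx (≢-sym y≢z') (≢-sym z≢z') (≢-sym x'≢z')
        y≁z' : ¬ Adj G y z'
        y≁z' = not-adj Ny (≢-sym x≢z') (≢-sym z≢z') (≢-sym y'≢z')
        x'≁z' : ¬ Adj G x' z'
        x'≁z' = not-adj Nx' (≢-sym x≢z') (≢-sym s≢z') (≢-sym t≢z')
        y'≁z' : ¬ Adj G y' z'
        y'≁z' = not-adj Ny'′ (≢-sym y≢z') (≢-sym s≢z') (≢-sym t≢z')
        s≁z' : ¬ Adj G s z'
        s≁z' = not-adj Ns (≢-sym x'≢z') (≢-sym t≢z') z'≢s'
        t≁z' : ¬ Adj G t z'
        t≁z' = not-adj Nt (≢-sym x'≢z') (≢-sym s≢z') (λ z'≡t' → y'≢z' (trans (≡-sym t'≡y') (≡-sym z'≡t')))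

        module Beyond (u : Fin n) (z'~u : Adj G z' u) (u≢z : u ≢ z) where
          apart : ∀ {v} → ¬ Adj G v z' → u ≢ v
          apart v≁z' u≡v = v≁z' (adj-sym G (subst (Adj G z') u≡v z'~u))
          u≢z' : u ≢ z'
          u≢z' = ≢-sym (adj⇒≢ G z'~u)
          u-out : All (u ≢_) D₁
          u-out = apart s≁z' ∷ apart t≁z' ∷ apart x≁z' ∷ apart y≁z' ∷ u≢z ∷ apart x'≁z' ∷ apart y'≁z' ∷ u≢z' ∷ []
          z≁u : ¬ Adj G z u
          z≁u = not-adj Nz (apart x≁z') (apart y≁z') u≢z'
          x≁u : ¬ Adj G x u
          x≁u = not-adj Nx (apart y≁z') u≢z (apart x'≁z')
          y≁u : ¬ Adj G y u
          y≁u = not-adj Ny (apart x≁z') u≢z (apart y'≁z')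
          x'≁u : ¬ Adj G x' u
          x'≁u = not-adj Nx' (apart x≁z') (apart s≁z') (apart t≁z')
          y'≁u : ¬ Adj G y' u
          y'≁u = not-adj Ny'′ (apart y≁z') (apart s≁z') (apart t≁z')
          s≁u : ¬ Adj G s u
          s≁u = not-adj Ns (apart x'≁z') (apart t≁z') (λ u≡s' → apart y'≁z' (trans u≡s' s'≡y'))
          t≁u : ¬ Adj G t u
          t≁u = not-adj Nt (apart x'≁z') (apart s≁z') (λ u≡t' → apart y'≁z' (trans u≡t' t'≡y'))

        u₁ : Fin n
        u₁ = proj₁ (nbhd₁ (adj-sym G (Nbhd.vc Nz)))
        u₂ : Fin n
        u₂ = proj₁ (proj₂ (nbhd₁ (adj-sym G (Nbhd.vc Nz))))
        Nz' : Nbhd G z' z u₁ u₂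
        Nz' = proj₂ (proj₂ (nbhd₁ (adj-sym G (Nbhd.vc Nz))))
        module U₁ = Beyond u₁ (Nbhd.vb Nz') (≢-sym (Nbhd.a≢b Nz'))
        module U₂ = Beyond u₂ (Nbhd.vc Nz') (≢-sym (Nbhd.a≢c Nz'))

        u₁~u₂ : Adj G u₁ u₂
        u₁~u₂ = claw-pair claw-free Nz' U₁.z≁u U₂.z≁u

        w : Fin n
        w = proj₁ (nbhd₂ (adj-sym G (Nbhd.vb Nz')) u₁~u₂ (adj⇒≢ G (Nbhd.vc Nz')))
        Nu₁ : Nbhd G u₁ z' u₂ w
        Nu₁ = proj₂ (nbhd₂ (adj-sym G (Nbhd.vb Nz')) u₁~u₂ (adj⇒≢ G (Nbhd.vc Nz')))

        L₂ : List (Fin n)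
        L₂ = u₁ ∷ L₁
        cu₁ : Colours L₂ u₁
        cu₁ = initially (here refl)
        cu₂ : Colours L₂ u₂
        cu₂ = forced Nz' (extend u₁ (extend s cz)) cu₁ (extend u₁ (extend s cz'))
        cw : Colours L₂ w
        cw = forced Nu₁ (extend u₁ (extend s cz')) cu₂ cu₁

        w-out : All (w ≢_) (u₁ ∷ u₂ ∷ D₁)
        w-out = ≢-sym (adj⇒≢ G (Nbhd.vc Nu₁)) ∷ ≢-sym (Nbhd.b≢c Nu₁) ∷
                apart U₁.s≁u ∷ apart U₁.t≁u ∷ apart U₁.x≁u ∷ apart U₁.y≁u ∷ apart U₁.z≁u ∷
                apart U₁.x'≁u ∷ apart U₁.y'≁u ∷ ≢-sym (Nbhd.a≢c Nu₁) ∷ []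
          where
          apart : ∀ {v} → ¬ Adj G v u₁ → w ≢ v
          apart v≁u₁ w≡v = v≁u₁ (adj-sym G (subst (Adj G u₁) w≡v (Nbhd.vc Nu₁)))

        seed : Seed G
        seed = seed-from L₂ (here refl) (anchored-∷ G (adj-sym G (Nbhd.vb Nz')) (colouring (extend u₁ (extend s cz'))) L₁-anchored)
          (w ∷ u₁ ∷ u₂ ∷ D₁) (w-out ∷ (Nbhd.b≢c Nz' ∷ U₁.u-out) ∷ U₂.u-out ∷ D₁-distinct)
          (cw ∷ cu₁ ∷ cu₂ ∷ All.map (extend u₁) D₁-coloured) ≤-refl

      -- If t' = z', the third neighbour y'' of y' (besides y and s) is forced; it is new, since
      -- y'' = z' would make N(y') = {y, s, z'} a claw.
      module Crossing (t'≡z' : t' ≡ z') where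
        y'' : Fin n
        y'' = proj₁ (nbhd₂ (adj-sym G (Nbhd.vc Ny)) (adj-sym G s~y') (≢-sym Os.w≢y))
        Ny'′ : Nbhd G y' y s y''
        Ny'′ = proj₂ (nbhd₂ (adj-sym G (Nbhd.vc Ny)) (adj-sym G s~y') (≢-sym Os.w≢y))
        cy'' : Colours L₁ y''
        cy'' = forced Ny'′ (extend s cy) cs (extend s cy')
        apart : ∀ {v} → ¬ Adj G v y' → y'' ≢ v
        apart v≁y' y''≡v = v≁y' (adj-sym G (subst (Adj G y') y''≡v (Nbhd.vc Ny'′)))
        y''-out : y'' ≢ z' → All (y'' ≢_) D₁
        y''-out y''≢z' = ≢-sym (Nbhd.b≢c Ny'′) ∷
          apart (not-adj Nt (≢-sym x'≢y') (≢-sym s≢y') (λ y'≡t' → y'≢z' (trans y'≡t' t'≡z'))) ∷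
          apart (not-adj Nx (≢-sym y≢y') (≢-sym z≢y') (≢-sym x'≢y')) ∷
          ≢-sym (Nbhd.a≢c Ny'′) ∷
          apart (not-adj Nz (≢-sym x≢y') (≢-sym y≢y') y'≢z') ∷
          apart (not-adj Nx' (≢-sym x≢y') (≢-sym s≢y') (≢-sym t≢y')) ∷
          ≢-sym (adj⇒≢ G (Nbhd.vc Ny'′)) ∷ y''≢z' ∷ []

        seed : Seed G
        seed with y'' ≟ z'
        ... | no y''≢z' = seed-with cy'' (y''-out y''≢z')
        ... | yes y''≡z' with claw-edge claw-free (subst (Nbhd G y' y s) y''≡z' Ny'′)
        ...   | inj₁ y~s         = ⊥-elim (not-adj Ny Os.w≢x Os.w≢z s≢y' y~s)
        ...   | inj₂ (inj₁ y~z') = ⊥-elim (not-adj Ny (≢-sym x≢z') (≢-sym z≢z') (≢-sym y'≢z') y~z')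
        ...   | inj₂ (inj₂ s~z') = ⊥-elim (not-adj Ns (≢-sym x'≢z') (≢-sym t≢z') z'≢s' s~z')

      seed : Seed G
      seed with t' ≟ y' | t' ≟ z'
      ... | no t'≢y' | no t'≢z' = seed-with ct' (t'-out t'≢y' t'≢z')
      ... | yes t'≡y' | _        = Closed.seed t'≡y'
      ... | no _      | yes t'≡z' = Crossing.seed t'≡z'

-- Either [x, y, z] is a Seed or D₀ is all it colours.  In the latter case let
-- N(x') = {x, s, t}, with s ~ t by claw-freeness.  If s or t is one of y', z', then the other is
-- forced as well and lies in D₀, and the edges found make D₀ a prism.  Otherwise s, t are new and
-- the extended seed applies: s' new gives nine coloured vertices, while s' = y' or s' = z' is the
-- tail (for the triangle read as x y z or as x z y).
module Triangle {n : ℕ} (G : Graph n) (cubic : Cubic G) (connected : Connected G) (claw-free : ClawFree G)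
  {x y z x' y' z' : Fin n} (Nx : Nbhd G x y z x') (Ny : Nbhd G y x z y') (Nz : Nbhd G z x y z')
  (x'≢y' : x' ≢ y') (x'≢z' : x' ≢ z') (y'≢z' : y' ≢ z') where
  open Local G cubic
  open TriangleBasics G cubic claw-free Nx Ny Nz x'≢y' x'≢z' y'≢z'

  s : Fin n
  s = proj₁ (nbhd₁ (adj-sym G (Nbhd.vc Nx)))
  t : Fin n
  t = proj₁ (proj₂ (nbhd₁ (adj-sym G (Nbhd.vc Nx))))
  Nx' : Nbhd G x' x s t
  Nx' = proj₂ (proj₂ (nbhd₁ (adj-sym G (Nbhd.vc Nx))))

  module Os = Outer s (Nbhd.vb Nx') (Nbhd.a≢b Nx')
  module Ot = Outer t (Nbhd.vc Nx') (Nbhd.a≢c Nx')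

  s~t : Adj G s t
  s~t = claw-pair claw-free Nx' Os.x≁w Ot.x≁w

  s≢t : s ≢ t
  s≢t = Nbhd.b≢c Nx'

  prism : Adj G x' y' → Adj G y' z' → Adj G x' z' → Isomorphic G Prism
  prism x'~y' y'~z' x'~z' = Recognise.isomorphism G cubic connected prism-graph prism-cubic fzero (lookup D₀)
    (lookup-injective D₀ D₀-distinct) λ {i} {j} → realised-adj G (lookup D₀) prism-edges
      (x~y ∷ y~z ∷ x~z ∷ x'~y' ∷ y'~z' ∷ x'~z' ∷ Nbhd.vc Nx ∷ Nbhd.vc Ny ∷ Nbhd.vc Nz ∷ []) {i} {j}

  outer-D₀ : ∀ {v} → v ∈ₗ D₀ → v ≢ x → v ≢ y → v ≢ z → v ≢ x' → v ≡ y' ⊎ v ≡ z'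
  outer-D₀ (here v≡x)                                 v≢x _ _ _ = ⊥-elim (v≢x v≡x)
  outer-D₀ (there (here v≡y))                         _ v≢y _ _ = ⊥-elim (v≢y v≡y)
  outer-D₀ (there (there (here v≡z)))                 _ _ v≢z _ = ⊥-elim (v≢z v≡z)
  outer-D₀ (there (there (there (here v≡x'))))         _ _ _ v≢x' = ⊥-elim (v≢x' v≡x')
  outer-D₀ (there (there (there (there (here v≡y'))))) _ _ _ _ = inj₁ v≡y'
  outer-D₀ (there (there (there (there (there (here v≡z')))))) _ _ _ _ = inj₂ v≡z'

  module Exact (exact : ∀ {v} → Colours L₀ v → v ∈ₗ D₀) where

    -- If s is coloured, then x' forces t, which therefore lies in D₀ and is y' or z'; likewise for t.
    t-outer : Colours L₀ s → t ≡ y' ⊎ t ≡ z'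
    t-outer cs = outer-D₀ (exact (forced Nx' cx cs cx')) Ot.w≢x Ot.w≢y Ot.w≢z Ot.w≢x'
    s-outer : Colours L₀ t → s ≡ y' ⊎ s ≡ z'
    s-outer ct = outer-D₀ (exact (forced (nbhd-swap₂₃ Nx') cx ct cx')) Os.w≢x Os.w≢y Os.w≢z Os.w≢x'

    module New (s≢y' : s ≢ y') (s≢z' : s ≢ z') (t≢y' : t ≢ y') (t≢z' : t ≢ z') where
      s' : Fin n
      s' = proj₁ (nbhd₂ (adj-sym G (Nbhd.vb Nx')) s~t (adj⇒≢ G (Nbhd.vc Nx')))
      Ns : Nbhd G s x' t s'
      Ns = proj₂ (nbhd₂ (adj-sym G (Nbhd.vb Nx')) s~t (adj⇒≢ G (Nbhd.vc Nx')))
      t' : Fin n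
      t' = proj₁ (nbhd₂ (adj-sym G (Nbhd.vc Nx')) (adj-sym G s~t) (adj⇒≢ G (Nbhd.vb Nx')))
      Nt : Nbhd G t x' s t'
      Nt = proj₂ (nbhd₂ (adj-sym G (Nbhd.vc Nx')) (adj-sym G s~t) (adj⇒≢ G (Nbhd.vb Nx')))

      open Extended Nx' s~t Ns Nt s≢y' s≢z' t≢y' t≢z'

      seed : Seed G
      seed with s' ≟ y' | s' ≟ z'
      ... | yes s'≡y' | _ = Tail.seed s'≡y'
      ... | no _ | yes s'≡z' =
        TriangleBasics.Extended.Tail.seed G cubic claw-free (nbhd-swap₁₂ Nx) Nz Ny x'≢z' x'≢y' (≢-sym y'≢z')
          Nx' s~t Ns Nt s≢z' s≢y' t≢z' t≢y' s'≡z'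
      ... | no s'≢y' | no s'≢z' = seed-with cs' (s'-out s'≢y' s'≢z')

    seed-or-prism : Seed G ⊎ Isomorphic G Prism
    seed-or-prism with s ≟ y' | s ≟ z' | t ≟ y' | t ≟ z'
    ... | yes s≡y' | _ | _ | _ with t-outer (subst (Colours L₀) (≡-sym s≡y') cy')
    ...   | inj₁ t≡y' = ⊥-elim (s≢t (trans s≡y' (≡-sym t≡y')))
    ...   | inj₂ t≡z' = inj₂ (prism (subst (Adj G x') s≡y' (Nbhd.vb Nx')) (subst₂ (Adj G) s≡y' t≡z' s~t)
                                   (subst (Adj G x') t≡z' (Nbhd.vc Nx')))
    seed-or-prism | no _ | yes s≡z' | _ | _ with t-outer (subst (Colours L₀) (≡-sym s≡z') cz')
    ...   | inj₁ t≡y' = inj₂ (prism (subst (Adj G x') t≡y' (Nbhd.vc Nx')) (adj-sym G (subst₂ (Adj G) s≡z' t≡y' s~t))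
                                   (subst (Adj G x') s≡z' (Nbhd.vb Nx')))
    ...   | inj₂ t≡z' = ⊥-elim (s≢t (trans s≡z' (≡-sym t≡z')))
    seed-or-prism | no s≢y' | no s≢z' | yes t≡y' | _ =
      ⊥-elim ([ s≢y' , s≢z' ]′ (s-outer (subst (Colours L₀) (≡-sym t≡y') cy')))
    seed-or-prism | no s≢y' | no s≢z' | no _ | yes t≡z' =
      ⊥-elim ([ s≢y' , s≢z' ]′ (s-outer (subst (Colours L₀) (≡-sym t≡z') cz')))
    seed-or-prism | no s≢y' | no s≢z' | no t≢y' | no t≢z' = inj₁ (New.seed s≢y' s≢z' t≢y' t≢z')

  seed-or-prism : Seed G ⊎ Isomorphic G Prism
  seed-or-prism with seed-or-exact L₀ (here refl) L₀-anchored D₀ D₀-distinct D₀-coloured refl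
  ... | inj₁ seed  = inj₁ seed
  ... | inj₂ exact = Exact.seed-or-prism exact

clique-adj : ∀ {n} (G : Graph n) (V : List (Fin n)) → AllPairs (Adj G) V →
             ∀ {i j} → i ≢ j → Adj G (lookup V i) (lookup V j)
clique-adj G (v ∷ V) (v~V ∷ pairs) {fzero}  {fzero}  i≢j = ⊥-elim (i≢j refl)
clique-adj G (v ∷ V) (v~V ∷ pairs) {fzero}  {fsuc j} _   = All.lookup v~V (∈-lookup j)
clique-adj G (v ∷ V) (v~V ∷ pairs) {fsuc i} {fzero}  _   = adj-sym G (All.lookup v~V (∈-lookup i))
clique-adj G (v ∷ V) (v~V ∷ pairs) {fsuc i} {fsuc j} i≢j = clique-adj G V pairs (i≢j ∘ cong fsuc)

K4-adj⇒≢ : ∀ {i j} → T (K4 i j) → i ≢ j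
K4-adj⇒≢ {i} {j} with i ≟ j
... | yes _   = λ ()
... | no i≢j = λ _ → i≢j

Outcome : ∀ {n} → Graph n → Set
Outcome G = Seed G ⊎ Isomorphic G Prism ⊎ Isomorphic G N2

module Structure {n : ℕ} (G : Graph n) (cubic : Cubic G) (connected : Connected G) (claw-free : ClawFree G)
                 (not-K4 : ¬ Isomorphic G K4) where
  open Local G cubic

  diamond : ∀ {a b c d} → Nbhd G c a b d → Nbhd G d a b c → ¬ Adj G a b → Outcome G
  diamond Nc Nd a≁b = [ inj₁ , inj₂ ∘ inj₂ ]′ (Diamond.seed-or-necklace G cubic connected claw-free Nc Nd a≁b)

  -- If r = p' = q',
  -- then {v, p, q, r} is a K4, hence all of G; if exactly two of r, p', q' coincide we have a
  -- diamond; otherwise the triangle case applies.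
  triangle : ∀ {v p q r} → Nbhd G v p q r → Adj G p q → Outcome G
  triangle {v} {p} {q} {r} N p~q
    with p' , Np ← nbhd₂ (adj-sym G (Nbhd.va N)) p~q (adj⇒≢ G (Nbhd.vb N))
       | q' , Nq ← nbhd₂ (adj-sym G (Nbhd.vb N)) (adj-sym G p~q) (adj⇒≢ G (Nbhd.va N))
    with r ≟ p' | r ≟ q' | p' ≟ q'
  ... | yes refl | yes refl | _ = ⊥-elim (not-K4 (Recognise.isomorphism G cubic connected K4-graph K4-cubic fzero
          (lookup V) (lookup-injective V V-distinct) (clique-adj G V V-clique ∘ K4-adj⇒≢)))
    where
    V : List (Fin n)
    V = v ∷ p ∷ q ∷ r ∷ []
    V-distinct : Unique V
    V-distinct = (adj⇒≢ G (Nbhd.va N) ∷ adj⇒≢ G (Nbhd.vb N) ∷ adj⇒≢ G (Nbhd.vc N) ∷ []) ∷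
                 (Nbhd.a≢b N ∷ Nbhd.a≢c N ∷ []) ∷ (Nbhd.b≢c N ∷ []) ∷ [] ∷ []
    V-clique : AllPairs (Adj G) V
    V-clique = (Nbhd.va N ∷ Nbhd.vb N ∷ Nbhd.vc N ∷ []) ∷ (p~q ∷ Nbhd.vc Np ∷ []) ∷ (Nbhd.vc Nq ∷ []) ∷ [] ∷ []
  ... | yes refl | no r≢q' | _ = diamond (nbhd-rotate N) (nbhd-rotate Np)
          (not-adj Nq (≢-sym (adj⇒≢ G (Nbhd.vc N))) (≢-sym (Nbhd.a≢c N)) r≢q')
  ... | no r≢p' | yes refl | _ = diamond (nbhd-swap₂₃ N) (nbhd-rotate Nq)
          (not-adj Np (≢-sym (adj⇒≢ G (Nbhd.vc N))) (≢-sym (Nbhd.b≢c N)) r≢p')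
  ... | no r≢p' | no r≢q' | yes refl = diamond (nbhd-swap₂₃ Np) (nbhd-swap₂₃ Nq)
          (not-adj N (≢-sym (adj⇒≢ G (Nbhd.vc Np))) (≢-sym (Nbhd.b≢c Np)) (≢-sym r≢p'))
  ... | no r≢p' | no r≢q' | no p'≢q' =
    [ inj₁ , inj₂ ∘ inj₁ ]′ (Triangle.seed-or-prism G cubic connected claw-free N Np Nq r≢p' r≢q' p'≢q')

  -- By claw-freeness, the neighbourhood of any vertex contains an edge, i.e. a triangle.
  outcome : Outcome G
  outcome with _ , _ , _ , N ← cubic-nbhd G cubic (proj₁ connected) with claw-edge claw-free N
  ... | inj₁ a~b        = triangle N a~b
  ... | inj₂ (inj₁ a~c) = triangle (nbhd-swap₂₃ N) a~c
  ... | inj₂ (inj₂ b~c) = triangle (nbhd-rotate N) b~c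

module Conclusion {n : ℕ} (G : Graph n) (cubic : Cubic G) (connected : Connected G) {k : ℕ}
                  (F : IsForcingNumber G k) where

  exceptional⇒extremal : Isomorphic G N2 ⊎ Isomorphic G Prism → 2 * k ≡ n
  exceptional⇒extremal (inj₁ iso) = extremal-iso G N2-graph N2-forcing-number refl iso F
  exceptional⇒extremal (inj₂ iso) = extremal-iso G prism-graph prism-forcing-number refl iso F

  bound : Outcome G → 2 * k ≤ n
  bound (inj₁ seed)        = <⇒≤ (seed⇒2F<n G cubic connected seed F)
  bound (inj₂ (inj₁ iso)) = ≤-reflexive (exceptional⇒extremal (inj₂ iso))
  bound (inj₂ (inj₂ iso)) = ≤-reflexive (exceptional⇒extremal (inj₁ iso))

  extremal⇒exceptional : Outcome G → 2 * k ≡ n → Isomorphic G N2 ⊎ Isomorphic G Prism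
  extremal⇒exceptional (inj₁ seed) extremal = ⊥-elim (<-irrefl extremal (seed⇒2F<n G cubic connected seed F))
  extremal⇒exceptional (inj₂ (inj₁ iso)) _ = inj₂ iso
  extremal⇒exceptional (inj₂ (inj₂ iso)) _ = inj₁ iso

theorem3 : ∀ {n : ℕ} (G : Graph n) → ¬ Isomorphic G K4 → Connected G → ClawFree G → Cubic G →
    ∃ λ k → IsForcingNumber G k × 2 * k ≤ n × (2 * k ≡ n ⇔ (Isomorphic G N2 ⊎ Isomorphic G Prism))
theorem3 G not-K4 connected claw-free cubic =
  k , F , bound outcome , mk⇔ (extremal⇒exceptional outcome) exceptional⇒extremal
  where
  k : ℕ
  k = proj₁ (forcing-number G)
  F : IsForcingNumber G k
  F = proj₂ (forcing-number G)
  outcome : Outcome G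
  outcome = Structure.outcome G cubic connected claw-free not-K4
  open Conclusion G cubic connected F
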